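{- Let $T$ be the $k$-regular tree and $P$ the infinite path. Let $u:V(T)\times\mathbb Z_+\to\mathbb C$, and let $M_u(x,r,n)$ denote the spherical mean of $x\mapsto u(x,n)$. Then: (1) $u$ satisfies $\Delta_T u(x,n)+\partial_n u(x,n)=0$ for all $x\in V(T)$, $n\in\mathbb Z_+$ if and only if $M_u$ satisfies $(\Delta_P+(2-k)\partial_r)M_u(x,r,n)+\partial_nM_u(x,r,n)=0$ for all $x\in V(T)$, $r,n\in\mathbb Z_+$; (2) $u$ satisfies $\Delta_T u(x,n)+\partial_n^2 u(x,n)=0$ for all $x\in V(T)$, $n\in\mathbb Z_+$ if and only if $M_u$ satisfies $(\Delta_P+(2-k)\partial_r)M_u(x,r,n)+\partial_n^2M_u(x,r,n)=0$ for all $x\in V(T)$, $r,n\in\mathbb Z_+$.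
   Context: $T$ is the infinite $k$-regular tree with graph distance $d$; $S(r)=|\{z:d(z,x)=r\}|$ ($=1$ for $r=0$, $k(k-1)^{r-1}$ for $r>0$). $M_u(x,r,n)=\frac{1}{S(r)}\sum_{d(z,x)=r}u(z,n)$ for $r\ge0$, extended evenly in $r$ to $r\in\mathbb Z$. $\Delta_T F(x)=kF(x)-\sum_{y\sim x}F(y)$ (acting in $x$); $P$ is the path on $\mathbb Z$ and $\Delta_P v(r)=2v(r)-v(r+1)-v(r-1)$ (acting in $r$); $\partial_r v(r)=v(r+1)-v(r)$; $\partial_n v(n)=v(n+1)-v(n)$ in the time variable. -}

module Defs where

open import Level using (Level)
open import Data.Nat as ℕ using (ℕ; zero; suc; _∸_; _≤_; _^_)
open import Data.Fin using (Fin)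
open import Data.Fin.Properties using () renaming (_≟_ to _≟ᶠ_)
open import Data.Nat.Properties using () renaming (_≟_ to _≟ⁿ_)
open import Data.Bool using (Bool; true; false; not; _∧_; T; if_then_else_)
open import Data.Maybe using (Maybe; just; nothing)
open import Data.List using (List; []; _∷_; [_]; _++_; length; map; concatMap; mapMaybe; allFin; upTo; foldr; filterᵇ)
open import Data.Product using (Σ; _,_; proj₁)
open import Data.Integer as ℤ using (ℤ; ∣_∣)
open import Relation.Nullary using (yes; no)
open import Relation.Nullary.Decidable using (⌊_⌋; T?)
open import Algebra.Bundles using (CommutativeRing)

-- The infinite k-regular tree T (for k ≥ 2), realised as the Cayley graph
-- of the free product of k copies of ℤ/2: a vertex is a reduced word over
-- the alphabet Fin k (no two consecutive letters equal), read from the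
-- root.

module Tree (k : ℕ) where

  Word : Set
  Word = List (Fin k)

  reducedᵇ : Word → Bool
  reducedᵇ [] = true
  reducedᵇ (a ∷ []) = true
  reducedᵇ (a ∷ b ∷ w) = not ⌊ a ≟ᶠ b ⌋ ∧ reducedᵇ (b ∷ w)

  Vertex : Set
  Vertex = Σ Word (λ w → T (reducedᵇ w))

  toVertex : Word → Maybe Vertex
  toVertex w with T? (reducedᵇ w)
  ... | yes p = just (w , p)
  ... | no _ = nothing

  dropLast : Word → Word
  dropLast [] = []
  dropLast (a ∷ []) = []
  dropLast (a ∷ b ∷ w) = a ∷ dropLast (b ∷ w)

  -- candidate neighbours (non-reduced ones are discarded by toVertex)
  parentCand : Word → List Word
  parentCand [] = []
  parentCand (a ∷ w) = [ dropLast (a ∷ w) ]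

  neighbours : Vertex → List Vertex
  neighbours (w , _) =
    mapMaybe toVertex (parentCand w ++ map (λ a → w ++ [ a ]) (allFin k))

  lcp : Word → Word → ℕ
  lcp (a ∷ v) (b ∷ w) = if ⌊ a ≟ᶠ b ⌋ then suc (lcp v w) else 0
  lcp _ _ = 0

  d : Vertex → Vertex → ℕ
  d (x , _) (y , _) = (length x ℕ.+ length y) ∸ (2 ℕ.* lcp x y)

  wordsOfLength : ℕ → List Word
  wordsOfLength zero = [ [] ]
  wordsOfLength (suc n) = concatMap (λ a → map (a ∷_) (wordsOfLength n)) (allFin k)

  ball : ℕ → List Vertex
  ball L = mapMaybe toVertex (concatMap wordsOfLength (upTo (suc L)))

  -- the sphere {z : d(z,x) = r}, enumerated (each vertex exactly once);
  -- every such z has length ≤ |x| + r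
  sphere : Vertex → ℕ → List Vertex
  sphere x r = filterᵇ (λ z → ⌊ d z x ≟ⁿ r ⌋) (ball (length (proj₁ x) ℕ.+ r))

  -- S(r) = |{z : d(z,x) = r}|
  S : ℕ → ℕ
  S zero = 1
  S (suc r) = k ℕ.* ((k ∸ 1) ^ r)

-- Scalars: a commutative ring R together with inverses of the positive
-- integers (e.g. ℂ).  ι n is the image of n in R.

module Scalars {c ℓ : Level} (R : CommutativeRing c ℓ) where
  open CommutativeRing R

  ι : ℕ → Carrier
  ι zero = 0#
  ι (suc n) = 1# + ι n

  sumR : List Carrier → Carrier
  sumR = foldr _+_ 0#

  InversesOfPositiveIntegers : (ℕ → Carrier) → Set ℓ
  InversesOfPositiveIntegers inv = (n : ℕ) → ι (suc n) * inv (suc n) ≈ 1#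

module Equations {c ℓ : Level} (k : ℕ) (R : CommutativeRing c ℓ)
                 (inv : ℕ → CommutativeRing.Carrier R) where
  open CommutativeRing R
  open Tree k
  open Scalars R

  Fn : Set c
  Fn = Vertex → ℕ → Carrier

  M : Fn → Vertex → ℕ → ℕ → Carrier
  M u x r n = inv (S r) * sumR (map (λ z → u z n) (sphere x r))

  -- even extension to r ∈ ℤ
  Mℤ : Fn → Vertex → ℤ → ℕ → Carrier
  Mℤ u x r n = M u x ∣ r ∣ n

  ΔT : Fn → Vertex → ℕ → Carrier
  ΔT u x n = ι k * u x n - sumR (map (λ y → u y n) (neighbours x))

  ∂n : Fn → Vertex → ℕ → Carrier
  ∂n u x n = u x (suc n) - u x n

  ∂n² : Fn → Vertex → ℕ → Carrier
  ∂n² u x n = ∂n u x (suc n) - ∂n u x n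

  ΔP : (ℤ → Carrier) → ℤ → Carrier
  ΔP f r = ι 2 * f r - f (r ℤ.+ ℤ.+ 1) - f (r ℤ.- ℤ.+ 1)

  ∂r : (ℤ → Carrier) → ℤ → Carrier
  ∂r f r = f (r ℤ.+ ℤ.+ 1) - f r

  LM : Fn → Vertex → ℤ → ℕ → Carrier
  LM u x r n = ΔP (λ s → Mℤ u x s n) r + (ι 2 - ι k) * ∂r (λ s → Mℤ u x s n) r

  ∂nM : Fn → Vertex → ℤ → ℕ → Carrier
  ∂nM u x r n = Mℤ u x r (suc n) - Mℤ u x r n

  ∂n²M : Fn → Vertex → ℤ → ℕ → Carrier
  ∂n²M u x r n = ∂nM u x r (suc n) - ∂nM u x r n

  HeatT : Fn → Set ℓ
  HeatT u = (x : Vertex) (n : ℕ) → ΔT u x n + ∂n u x n ≈ 0#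

  HeatM : Fn → Set ℓ
  HeatM u = (x : Vertex) (r n : ℕ) → LM u x (ℤ.+ r) n + ∂nM u x (ℤ.+ r) n ≈ 0#

  WaveT : Fn → Set ℓ
  WaveT u = (x : Vertex) (n : ℕ) → ΔT u x n + ∂n² u x n ≈ 0#

  WaveM : Fn → Set ℓ
  WaveM u = (x : Vertex) (r n : ℕ) → LM u x (ℤ.+ r) n + ∂n²M u x (ℤ.+ r) n ≈ 0#

module Submission where

-- The heart is the identity  (Δ_P + (2-k) ∂_r) M_u(x,r,n) = mean over
-- S(x,r) of Δ_T u(·,n)  (SphericalMeans.Means.mean-ΔT).  It rests on the
-- local structure of spheres: summing the neighbour sums of f over
-- S(x,r+1) counts each vertex of S(x,r) (k-1) times (k times if r = 0)
-- and each vertex of S(x,r+2) once, and |S(x,r+1)| = (k-1)|S(x,r)|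
-- (k|S(x,0)| if r = 0).  The neighbour-sum identity is proved by double
-- counting: vertices are the reduced words, sums over vertices become
-- weighted sums over all short words (BallSums), adjacency multiplicities
-- are symmetric, and the local count of neighbours at a given distance is
-- read off from how the distance to x changes along an edge (Words,
-- NeighbourCount, SphereSums).  Since taking means commutes with the time
-- differences, one direction of each equivalence follows by averaging and
-- the other by evaluating at radius 0 (transference).

open import Defs
open import Level using (Level)
open import Data.Nat using (ℕ; _≤_)
open import Data.Product using (_×_)
open import Function.Bundles using (_⇔_; mk⇔)
open import Algebra.Bundles using (CommutativeRing)

open import Algebra.Bundles using (RawRing)
import Algebra.Solver.Ring.AlmostCommutativeRing as ACR
open import Data.Bool using (Bool; true; false; not; _∧_; if_then_else_; T)
open import Data.Bool.Properties using (∧-assoc; ∧-zeroʳ; ∧-identityʳ; T-irrelevant)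
open import Data.Empty using (⊥-elim)
open import Data.Fin as Fin using (Fin)
open import Data.Fin.Properties using () renaming (_≟_ to _≟ᶠ_)
open import Data.Integer as ℤ using (ℤ; +_; -[1+_])
import Data.Integer.Properties as ℤP
open import Data.List
  using (List; []; _∷_; [_]; _++_; length; map; concatMap; mapMaybe; allFin; filterᵇ; upTo)
open import Data.List.Properties using (length-++; map-tabulate; upTo-∷ʳ)
open import Data.List.Relation.Unary.All using (All; []; _∷_) renaming (map to All-map)
import Data.List.Relation.Unary.All.Properties as All
open import Data.Maybe using (Maybe; just; nothing; maybe; is-just)
open import Data.Nat as ℕ using (zero; suc; _∸_; _<_; _≡ᵇ_; z≤n; s≤s)
import Data.Nat.Properties as ℕP
open import Data.Product using (_,_; proj₁; proj₂)
import Data.Sign as Sign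
open import Data.Sum using (inj₁; inj₂)
open import Relation.Nullary using (yes; no)
open import Relation.Nullary.Decidable using (⌊_⌋; T?)
open import Relation.Binary.PropositionalEquality as P using (_≡_; _≢_)

module IntegerCoefficients {c ℓ : Level} (R : CommutativeRing c ℓ) where
  open CommutativeRing R
  open import Algebra.Properties.Ring ring
    using (-‿distribˡ-*; -‿distribʳ-*; -‿involutive; -0#≈0#; -‿+-comm)
  open import Algebra.Properties.Semiring.Mult semiring using (×-homo-+; ×1-homo-*) renaming (_×_ to _×ᴿ_)
  open import Relation.Binary.Reasoning.Setoid setoid
  open Scalars R using (ι)

  ι≡×1 : ∀ n → ι n ≡ n ×ᴿ 1#
  ι≡×1 zero = P.refl
  ι≡×1 (suc n) = P.cong (λ t → 1# + t) (ι≡×1 n)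

  ι-+ : ∀ m n → ι (m ℕ.+ n) ≈ ι m + ι n
  ι-+ m n rewrite ι≡×1 (m ℕ.+ n) | ι≡×1 m | ι≡×1 n = ×-homo-+ 1# m n

  ι-* : ∀ m n → ι (m ℕ.* n) ≈ ι m * ι n
  ι-* m n rewrite ι≡×1 (m ℕ.* n) | ι≡×1 m | ι≡×1 n = ×1-homo-* m n

  ιℤ : ℤ → Carrier
  ιℤ (+ n) = ι n
  ιℤ -[1+ n ] = - ι (suc n)

  private
    x-0≈x : ∀ x → x - 0# ≈ x
    x-0≈x x = trans (+-congˡ -0#≈0#) (+-identityʳ x)

    1+a-[1+b]≈a-b : ∀ a b → (1# + a) - (1# + b) ≈ a - b
    1+a-[1+b]≈a-b a b = begin
      (1# + a) + - (1# + b)    ≈⟨ +-congˡ (sym (-‿+-comm 1# b)) ⟩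
      (1# + a) + (- 1# + - b)  ≈⟨ +-congʳ (+-comm 1# a) ⟩
      (a + 1#) + (- 1# + - b)  ≈⟨ +-assoc a 1# _ ⟩
      a + (1# + (- 1# + - b))  ≈⟨ +-congˡ (sym (+-assoc 1# (- 1#) (- b))) ⟩
      a + ((1# - 1#) + - b)    ≈⟨ +-congˡ (+-congʳ (-‿inverseʳ 1#)) ⟩
      a + (0# + - b)           ≈⟨ +-congˡ (+-identityˡ (- b)) ⟩
      a - b                    ∎

  ιℤ-⊖ : ∀ m n → ιℤ (m ℤ.⊖ n) ≈ ι m - ι n
  ιℤ-⊖ m zero rewrite ℤP.⊖-≥ {m} {0} ℕ.z≤n = sym (x-0≈x (ι m))
  ιℤ-⊖ zero (suc n) = sym (+-identityˡ _)
  ιℤ-⊖ (suc m) (suc n) rewrite ℤP.[1+m]⊖[1+n]≡m⊖n m n =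
    trans (ιℤ-⊖ m n) (sym (1+a-[1+b]≈a-b (ι m) (ι n)))

  ιℤ-+ : ∀ i j → ιℤ (i ℤ.+ j) ≈ ιℤ i + ιℤ j
  ιℤ-+ -[1+ m ] -[1+ n ] = begin
    - (1# + ι (suc (m ℕ.+ n)))      ≈⟨ -‿cong (+-congˡ (ι-+ (suc m) n)) ⟩
    - (1# + (ι (suc m) + ι n))      ≈⟨ -‿cong (sym (+-assoc 1# _ _)) ⟩
    - ((1# + ι (suc m)) + ι n)      ≈⟨ -‿cong (+-congʳ (+-comm 1# _)) ⟩
    - ((ι (suc m) + 1#) + ι n)      ≈⟨ -‿cong (+-assoc _ 1# _) ⟩
    - (ι (suc m) + ι (suc n))       ≈⟨ sym (-‿+-comm _ _) ⟩
    - ι (suc m) + - ι (suc n)       ∎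
  ιℤ-+ -[1+ m ] (+ n) = trans (ιℤ-⊖ n (suc m)) (+-comm _ _)
  ιℤ-+ (+ m) -[1+ n ] = ιℤ-⊖ m (suc n)
  ιℤ-+ (+ m) (+ n) = ι-+ m n

  ιℤ-- : ∀ i → ιℤ (ℤ.- i) ≈ - ιℤ i
  ιℤ-- -[1+ n ] = sym (-‿involutive _)
  ιℤ-- (+ zero) = sym -0#≈0#
  ιℤ-- (+ suc n) = refl

  ιℤ-+◃ : ∀ n → ιℤ (Sign.+ ℤ.◃ n) ≈ ι n
  ιℤ-+◃ zero = refl
  ιℤ-+◃ (suc n) = refl

  ιℤ--◃ : ∀ n → ιℤ (Sign.- ℤ.◃ n) ≈ - ι n
  ιℤ--◃ zero = sym -0#≈0#
  ιℤ--◃ (suc n) = refl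

  ιℤ-* : ∀ i j → ιℤ (i ℤ.* j) ≈ ιℤ i * ιℤ j
  ιℤ-* (+ m) (+ n) = trans (ιℤ-+◃ (m ℕ.* n)) (ι-* m n)
  ιℤ-* (+ m) -[1+ n ] =
    trans (ιℤ--◃ (m ℕ.* suc n)) (trans (-‿cong (ι-* m (suc n))) (-‿distribʳ-* _ _))
  ιℤ-* -[1+ m ] (+ n) =
    trans (ιℤ--◃ (suc m ℕ.* n)) (trans (-‿cong (ι-* (suc m) n)) (-‿distribˡ-* _ _))
  ιℤ-* -[1+ m ] -[1+ n ] = begin
    ιℤ (Sign.+ ℤ.◃ (suc m ℕ.* suc n))  ≈⟨ ιℤ-+◃ (suc m ℕ.* suc n) ⟩
    ι (suc m ℕ.* suc n)                ≈⟨ ι-* (suc m) (suc n) ⟩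
    ι (suc m) * ι (suc n)              ≈⟨ sym (-‿involutive _) ⟩
    - - (ι (suc m) * ι (suc n))        ≈⟨ -‿cong (-‿distribˡ-* _ _) ⟩
    - (- ι (suc m) * ι (suc n))        ≈⟨ -‿distribʳ-* _ _ ⟩
    - ι (suc m) * - ι (suc n)          ∎

  ℤ-rawRing : RawRing _ _
  ℤ-rawRing = record
    { Carrier = ℤ ; _≈_ = _≡_ ; _+_ = ℤ._+_ ; _*_ = ℤ._*_ ; -_ = ℤ.-_ ; 0# = + 0 ; 1# = + 1 }

  ιℤ-morphism : ACR._-Raw-AlmostCommutative⟶_ ℤ-rawRing (ACR.fromCommutativeRing R)
  ιℤ-morphism = record
    { ⟦_⟧ = ιℤ ; +-homo = ιℤ-+ ; *-homo = ιℤ-* ; -‿homo = ιℤ--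
    ; 0-homo = refl ; 1-homo = +-identityʳ 1# }

  ιℤ-≟ : ∀ i j → Maybe (ιℤ i ≈ ιℤ j)
  ιℤ-≟ i j with i ℤP.≟ j
  ... | yes P.refl = just refl
  ... | no _ = nothing

  open import Algebra.Solver.Ring ℤ-rawRing (ACR.fromCommutativeRing R) ιℤ-morphism ιℤ-≟ public


module ListSums {c ℓ : Level} (R : CommutativeRing c ℓ) where
  open CommutativeRing R
  open Scalars R using (ι; sumR)
  open IntegerCoefficients R using (solve; _:=_; _:+_; _:-_)

  ∑ : ∀ {a} {A : Set a} → List A → (A → Carrier) → Carrier
  ∑ L h = sumR (map h L)

  𝟙 : Bool → Carrier
  𝟙 b = if b then 1# else 0#

  if-as-𝟙 : ∀ b X → (if b then X else 0#) ≈ 𝟙 b * X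
  if-as-𝟙 true X = sym (*-identityˡ X)
  if-as-𝟙 false X = sym (zeroˡ X)

  private variable
    a b : Level
    A : Set a
    B : Set b

  ∑-cong : ∀ (L : List A) {h g} → (∀ x → h x ≈ g x) → ∑ L h ≈ ∑ L g
  ∑-cong [] e = refl
  ∑-cong (x ∷ L) e = +-cong (e x) (∑-cong L e)

  ∑-cong-All : ∀ {p} {Q : A → Set p} (L : List A) {h g} →
    All Q L → (∀ x → Q x → h x ≈ g x) → ∑ L h ≈ ∑ L g
  ∑-cong-All [] [] e = refl
  ∑-cong-All (x ∷ L) (q ∷ qs) e = +-cong (e x q) (∑-cong-All L qs e)

  ∑-++ : ∀ (L M : List A) h → ∑ (L ++ M) h ≈ ∑ L h + ∑ M h
  ∑-++ [] M h = sym (+-identityˡ _)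
  ∑-++ (x ∷ L) M h = trans (+-congˡ (∑-++ L M h)) (sym (+-assoc _ _ _))

  ∑-zero : ∀ (L : List A) {h} → (∀ x → h x ≈ 0#) → ∑ L h ≈ 0#
  ∑-zero [] e = refl
  ∑-zero (x ∷ L) e = trans (+-cong (e x) (∑-zero L e)) (+-identityˡ 0#)

  ∑-+ : ∀ (L : List A) h g → ∑ L (λ x → h x + g x) ≈ ∑ L h + ∑ L g
  ∑-+ [] h g = sym (+-identityˡ _)
  ∑-+ (x ∷ L) h g = trans (+-congˡ (∑-+ L h g))
    (solve 4 (λ a b c d → (a :+ b) :+ (c :+ d) := (a :+ c) :+ (b :+ d)) refl _ _ _ _)

  ∑-- : ∀ (L : List A) h g → ∑ L (λ x → h x - g x) ≈ ∑ L h - ∑ L g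
  ∑-- [] h g = sym (-‿inverseʳ 0#)
  ∑-- (x ∷ L) h g = trans (+-congˡ (∑-- L h g))
    (solve 4 (λ a b c d → (a :- b) :+ (c :- d) := (a :+ c) :- (b :+ d)) refl _ _ _ _)

  ∑-*ˡ : ∀ (L : List A) s h → ∑ L (λ x → s * h x) ≈ s * ∑ L h
  ∑-*ˡ [] s h = sym (zeroʳ _)
  ∑-*ˡ (x ∷ L) s h = trans (+-congˡ (∑-*ˡ L s h)) (sym (distribˡ _ _ _))

  ∑-*ʳ : ∀ (L : List A) s h → ∑ L (λ x → h x * s) ≈ ∑ L h * s
  ∑-*ʳ [] s h = sym (zeroˡ _)
  ∑-*ʳ (x ∷ L) s h = trans (+-congˡ (∑-*ʳ L s h)) (sym (distribʳ _ _ _))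

  ∑-filter : ∀ (L : List A) (p : A → Bool) h →
    ∑ (filterᵇ p L) h ≈ ∑ L (λ x → if p x then h x else 0#)
  ∑-filter [] p h = refl
  ∑-filter (x ∷ L) p h with p x
  ... | true = +-congˡ (∑-filter L p h)
  ... | false = trans (∑-filter L p h) (sym (+-identityˡ _))

  ∑-map : ∀ (L : List A) (f : A → B) h → ∑ (map f L) h ≈ ∑ L (λ x → h (f x))
  ∑-map [] f h = refl
  ∑-map (x ∷ L) f h = +-congˡ (∑-map L f h)

  ∑-concatMap : ∀ (L : List A) (f : A → List B) h →
    ∑ (concatMap f L) h ≈ ∑ L (λ x → ∑ (f x) h)
  ∑-concatMap [] f h = refl
  ∑-concatMap (x ∷ L) f h =
    trans (∑-++ (f x) (concatMap f L) h) (+-congˡ (∑-concatMap L f h))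

  ∑-mapMaybe : ∀ (L : List A) (f : A → Maybe B) h →
    ∑ (mapMaybe f L) h ≈ ∑ L (λ x → maybe h 0# (f x))
  ∑-mapMaybe [] f h = refl
  ∑-mapMaybe (x ∷ L) f h with f x
  ... | just y = +-congˡ (∑-mapMaybe L f h)
  ... | nothing = trans (∑-mapMaybe L f h) (sym (+-identityˡ _))

  ∑-swap : ∀ (L : List A) (M : List B) (F : A → B → Carrier) →
    ∑ L (λ x → ∑ M (F x)) ≈ ∑ M (λ y → ∑ L (λ x → F x y))
  ∑-swap [] M F = sym (∑-zero M (λ _ → refl))
  ∑-swap (x ∷ L) M F =
    trans (+-congˡ (∑-swap L M F)) (sym (∑-+ M (F x) (λ y → ∑ L (λ x → F x y))))

  ∑-allFin-suc : ∀ n (h : Fin (suc n) → Carrier) →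
    ∑ (allFin (suc n)) h ≡ h Fin.zero + ∑ (allFin n) (λ b → h (Fin.suc b))
  ∑-allFin-suc n h = P.cong (λ t → h Fin.zero + sumR t)
    (P.trans (map-tabulate Fin.suc h) (P.sym (map-tabulate (λ b → b) (λ b → h (Fin.suc b)))))

  open import Relation.Binary.Reasoning.Setoid setoid

  ∑-allFin-const : ∀ n X → ∑ (allFin n) (λ _ → X) ≈ ι n * X
  ∑-allFin-const zero X = sym (zeroˡ X)
  ∑-allFin-const (suc n) X = begin
    ∑ (allFin (suc n)) (λ _ → X)  ≡⟨ ∑-allFin-suc n (λ _ → X) ⟩
    X + ∑ (allFin n) (λ _ → X)    ≈⟨ +-cong (sym (*-identityˡ X)) (∑-allFin-const n X) ⟩
    1# * X + ι n * X              ≈⟨ sym (distribʳ X 1# (ι n)) ⟩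
    ι (suc n) * X                 ∎

  ∑-delta : ∀ {n} (c : Fin n) (X : Fin n → Carrier) →
    ∑ (allFin n) (λ b → if ⌊ b ≟ᶠ c ⌋ then X b else 0#) ≈ X c
  ∑-delta {suc n} Fin.zero X = begin
    _                              ≡⟨ ∑-allFin-suc n _ ⟩
    X Fin.zero + ∑ (allFin n) _    ≈⟨ +-congˡ (∑-zero (allFin n) (λ _ → refl)) ⟩
    X Fin.zero + 0#                ≈⟨ +-identityʳ _ ⟩
    X Fin.zero                     ∎
  ∑-delta {suc n} (Fin.suc c) X = begin
    _                              ≡⟨ ∑-allFin-suc n _ ⟩
    0# + ∑ (allFin n) _            ≈⟨ +-identityˡ _ ⟩
    ∑ (allFin n) _                 ≈⟨ ∑-cong (allFin n) shift ⟩
    ∑ (allFin n) (λ b → if ⌊ b ≟ᶠ c ⌋ then X (Fin.suc b) else 0#)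
                                   ≈⟨ ∑-delta c (λ b → X (Fin.suc b)) ⟩
    X (Fin.suc c)                  ∎
    where
    shift : ∀ b → (if ⌊ Fin.suc b ≟ᶠ Fin.suc c ⌋ then X (Fin.suc b) else 0#)
                ≈ (if ⌊ b ≟ᶠ c ⌋ then X (Fin.suc b) else 0#)
    shift b with b ≟ᶠ c
    ... | yes _ = refl
    ... | no _ = refl


∧-trueˡ : ∀ {a b} → (a ∧ b) ≡ true → a ≡ true
∧-trueˡ {true} _ = P.refl

∧-trueʳ : ∀ {a b} → (a ∧ b) ≡ true → b ≡ true
∧-trueʳ {true} e = e

T⇒≡true : ∀ {b} → T b → b ≡ true
T⇒≡true {true} _ = P.refl

≡true⇒T : ∀ {b} → b ≡ true → T b
≡true⇒T P.refl = _

≡ᵇ-refl : ∀ n → (n ≡ᵇ n) ≡ true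
≡ᵇ-refl zero = P.refl
≡ᵇ-refl (suc n) = ≡ᵇ-refl n

≡ᵇ⇒≡ : ∀ {m n} → (m ≡ᵇ n) ≡ true → m ≡ n
≡ᵇ⇒≡ {m} {n} e = ℕP.≡ᵇ⇒≡ m n (≡true⇒T e)

≢⇒≡ᵇ-false : ∀ {m n} → m ≢ n → (m ≡ᵇ n) ≡ false
≢⇒≡ᵇ-false {m} {n} m≢n with m ≡ᵇ n in e
... | true = ⊥-elim (m≢n (≡ᵇ⇒≡ e))
... | false = P.refl

-- the sphere is cut out with ⌊ _≟_ ⌋, the counting works with _≡ᵇ_
⌊≟⌋≡≡ᵇ : ∀ m n → ⌊ m ℕP.≟ n ⌋ ≡ (m ≡ᵇ n)
⌊≟⌋≡≡ᵇ m n with m ℕP.≟ n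
... | yes P.refl = P.sym (≡ᵇ-refl m)
... | no m≢n with m ≡ᵇ n in e
...   | true = ⊥-elim (m≢n (≡ᵇ⇒≡ e))
...   | false = P.refl

≟ᶠ-refl : ∀ {n} (a : Fin n) → ⌊ a ≟ᶠ a ⌋ ≡ true
≟ᶠ-refl a with a ≟ᶠ a
... | yes _ = P.refl
... | no a≢a = ⊥-elim (a≢a P.refl)

≟ᶠ-sym : ∀ {n} (a b : Fin n) → ⌊ a ≟ᶠ b ⌋ ≡ ⌊ b ≟ᶠ a ⌋
≟ᶠ-sym a b with a ≟ᶠ b | b ≟ᶠ a
... | yes _ | yes _ = P.refl
... | no _ | no _ = P.refl
... | yes a≡b | no b≢a = ⊥-elim (b≢a (P.sym a≡b))
... | no a≢b | yes b≡a = ⊥-elim (a≢b (P.sym b≡a))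

≟ᶠ⇒≡ : ∀ {n} {a b : Fin n} → ⌊ a ≟ᶠ b ⌋ ≡ true → a ≡ b
≟ᶠ⇒≡ {a = a} {b} e with a ≟ᶠ b
... | yes a≡b = a≡b

bit : Bool → ℕ
bit true = 1
bit false = 0

-- The distance of a child y ++ [a] or of the parent of y from a fixed
-- vertex x differs by one from that of y; which way is decided by
-- whether the step moves along the geodesic towards x.
module Words (k : ℕ) where
  open Tree k

  _==_ : Word → Word → Bool
  [] == [] = true
  [] == (_ ∷ _) = false
  (_ ∷ _) == [] = false
  (a ∷ v) == (b ∷ w) = ⌊ a ≟ᶠ b ⌋ ∧ (v == w)

  ==-refl : ∀ w → (w == w) ≡ true
  ==-refl [] = P.refl
  ==-refl (a ∷ w) rewrite ≟ᶠ-refl a = ==-refl w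

  ==⇒≡ : ∀ v w → (v == w) ≡ true → v ≡ w
  ==⇒≡ [] [] _ = P.refl
  ==⇒≡ (a ∷ v) (b ∷ w) e =
    P.cong₂ _∷_ (≟ᶠ⇒≡ (∧-trueˡ e)) (==⇒≡ v w (∧-trueʳ {⌊ a ≟ᶠ b ⌋} e))

  ==-sym : ∀ v w → (v == w) ≡ (w == v)
  ==-sym [] [] = P.refl
  ==-sym [] (_ ∷ _) = P.refl
  ==-sym (_ ∷ _) [] = P.refl
  ==-sym (a ∷ v) (b ∷ w) = P.cong₂ _∧_ (≟ᶠ-sym a b) (==-sym v w)

  ==-snoc : ∀ p z (b a : Fin k) → ((p ++ [ b ]) == (z ++ [ a ])) ≡ ((p == z) ∧ ⌊ b ≟ᶠ a ⌋)
  ==-snoc [] [] b a = ∧-identityʳ _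
  ==-snoc [] (c ∷ []) b a = ∧-zeroʳ _
  ==-snoc [] (c ∷ d ∷ z) b a = ∧-zeroʳ _
  ==-snoc (c ∷ []) [] b a = ∧-zeroʳ _
  ==-snoc (c ∷ d ∷ p) [] b a = ∧-zeroʳ _
  ==-snoc (c ∷ p) (d ∷ z) b a =
    P.trans (P.cong (⌊ c ≟ᶠ d ⌋ ∧_) (==-snoc p z b a)) (P.sym (∧-assoc ⌊ c ≟ᶠ d ⌋ _ _))

  []≠snoc : ∀ z (a : Fin k) → ([] == (z ++ [ a ])) ≡ false
  []≠snoc [] a = P.refl
  []≠snoc (_ ∷ _) a = P.refl

  lastOf : Fin k → Word → Fin k
  lastOf c [] = c
  lastOf c (d ∷ q) = lastOf d q

  parent++last : ∀ c q → dropLast (c ∷ q) ++ [ lastOf c q ] ≡ c ∷ q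
  parent++last c [] = P.refl
  parent++last c (d ∷ q) = P.cong (c ∷_) (parent++last d q)

  length-snoc : ∀ (y : Word) a → length (y ++ [ a ]) ≡ suc (length y)
  length-snoc y a = P.trans (length-++ y) (ℕP.+-comm (length y) 1)

  length-parent : ∀ c q → length (c ∷ q) ≡ suc (length (dropLast (c ∷ q)))
  length-parent c q = P.trans (P.cong length (P.sym (parent++last c q)))
                              (length-snoc (dropLast (c ∷ q)) (lastOf c q))

  reduced-snoc : ∀ c q a →
    reducedᵇ ((c ∷ q) ++ [ a ]) ≡ (reducedᵇ (c ∷ q) ∧ not ⌊ lastOf c q ≟ᶠ a ⌋)
  reduced-snoc c [] a with ⌊ c ≟ᶠ a ⌋
  ... | true = P.refl
  ... | false = P.refl
  reduced-snoc c (d ∷ q) a = P.trans (P.cong (not ⌊ c ≟ᶠ d ⌋ ∧_) (reduced-snoc d q a))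
                                     (P.sym (∧-assoc (not ⌊ c ≟ᶠ d ⌋) _ _))

  reduced-tail : ∀ a w → reducedᵇ (a ∷ w) ≡ true → reducedᵇ w ≡ true
  reduced-tail a [] _ = P.refl
  reduced-tail a (b ∷ w) e = ∧-trueʳ {not ⌊ a ≟ᶠ b ⌋} e

  reduced-parent : ∀ c q → reducedᵇ (c ∷ q) ≡ true → reducedᵇ (dropLast (c ∷ q)) ≡ true
  reduced-parent c [] _ = P.refl
  reduced-parent c (d ∷ []) _ = P.refl
  reduced-parent c (d ∷ f ∷ q) e =
    P.cong₂ _∧_ (∧-trueˡ e) (reduced-parent d (f ∷ q) (reduced-tail c (d ∷ f ∷ q) e))

  next : Word → Word → Maybe (Fin k)
  next [] [] = nothing
  next [] (c ∷ x) = just c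
  next (b ∷ y) [] = nothing
  next (b ∷ y) (c ∷ x) = if ⌊ b ≟ᶠ c ⌋ then next y x else nothing

  _≐_ : Maybe (Fin k) → Fin k → Bool
  nothing ≐ a = false
  just c ≐ a = ⌊ a ≟ᶠ c ⌋

  ≐⇒≡ : ∀ e a → (e ≐ a) ≡ true → e ≡ just a
  ≐⇒≡ (just c) a eq = P.cong just (P.sym (≟ᶠ⇒≡ eq))

  lcp-snoc : ∀ y a x → lcp (y ++ [ a ]) x ≡ lcp y x ℕ.+ bit (next y x ≐ a)
  lcp-snoc [] a [] = P.refl
  lcp-snoc [] a (c ∷ x) with ⌊ a ≟ᶠ c ⌋
  ... | true = P.refl
  ... | false = P.refl
  lcp-snoc (b ∷ y) a [] = P.refl
  lcp-snoc (b ∷ y) a (c ∷ x) with ⌊ b ≟ᶠ c ⌋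
  ... | true = P.cong suc (lcp-snoc y a x)
  ... | false = P.refl

  lcp-≤ˡ : ∀ y x → lcp y x ≤ length y
  lcp-≤ˡ [] x = z≤n
  lcp-≤ˡ (b ∷ y) [] = z≤n
  lcp-≤ˡ (b ∷ y) (c ∷ x) with ⌊ b ≟ᶠ c ⌋
  ... | true = s≤s (lcp-≤ˡ y x)
  ... | false = z≤n

  lcp-≤ʳ : ∀ y x → lcp y x ≤ length x
  lcp-≤ʳ [] x = z≤n
  lcp-≤ʳ (b ∷ y) [] = z≤n
  lcp-≤ʳ (b ∷ y) (c ∷ x) with ⌊ b ≟ᶠ c ⌋
  ... | true = s≤s (lcp-≤ʳ y x)
  ... | false = z≤n

  lcp-refl : ∀ x → lcp x x ≡ length x
  lcp-refl [] = P.refl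
  lcp-refl (a ∷ x) rewrite ≟ᶠ-refl a = P.cong suc (lcp-refl x)

  lcp-full : ∀ y x → lcp y x ≡ length y → lcp y x ≡ length x → y ≡ x
  lcp-full [] [] _ _ = P.refl
  lcp-full [] (_ ∷ _) _ ()
  lcp-full (_ ∷ _) [] ()
  lcp-full (b ∷ y) (c ∷ x) e₁ e₂ with b ≟ᶠ c
  ... | yes b≡c = P.cong₂ _∷_ b≡c (lcp-full y x (ℕP.suc-injective e₁) (ℕP.suc-injective e₂))
  lcp-full (b ∷ y) (c ∷ x) () e₂ | no _

  next-just : ∀ y x c → next y x ≡ just c → (lcp y x ≡ length y) × (length y < length x)
  next-just [] (c' ∷ x) c e = P.refl , s≤s z≤n
  next-just (b ∷ y) (c' ∷ x) c e with ⌊ b ≟ᶠ c' ⌋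
  ... | true = let (p , q) = next-just y x c e in P.cong suc p , s≤s q
  next-just (b ∷ y) (c' ∷ x) c () | false

  next-nothing : ∀ y x → lcp y x ≡ length y → next y x ≡ nothing → length x ≤ length y
  next-nothing [] [] _ _ = z≤n
  next-nothing [] (c ∷ x) _ ()
  next-nothing (b ∷ y) [] _ _ = z≤n
  next-nothing (b ∷ y) (c ∷ x) e₁ e₂ with ⌊ b ≟ᶠ c ⌋
  ... | true = s≤s (next-nothing y x (ℕP.suc-injective e₁) e₂)
  next-nothing (b ∷ y) (c ∷ x) () e₂ | false

  next-not-last : ∀ c q x → reducedᵇ x ≡ true → (next (c ∷ q) x ≐ lastOf c q) ≡ false
  next-not-last c q [] _ = P.refl
  next-not-last c q (c' ∷ x) r with c ≟ᶠ c'
  next-not-last c q (c' ∷ x) r | no _ = P.refl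
  next-not-last c [] (c' ∷ []) r | yes _ = P.refl
  next-not-last c [] (.c ∷ a ∷ x) r | yes P.refl = not-true (∧-trueˡ r)
    where
    not-true : ∀ {b} → not b ≡ true → b ≡ false
    not-true {false} _ = P.refl
  next-not-last c (d ∷ q) (c' ∷ x) r | yes _ = next-not-last d q x (reduced-tail c' x r)

  dist : Word → Word → ℕ
  dist y x = (length y ℕ.+ length x) ∸ (2 ℕ.* lcp y x)

  2*lcp≤ : ∀ y x → 2 ℕ.* lcp y x ≤ length y ℕ.+ length x
  2*lcp≤ y x = ℕP.+-mono-≤ (lcp-≤ˡ y x)
    (ℕP.≤-trans (ℕP.≤-reflexive (ℕP.*-identityˡ (lcp y x))) (lcp-≤ʳ y x))

  dist-prefix : ∀ y x → lcp y x ≡ length y → dist y x ≡ length x ∸ length y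
  dist-prefix y x e = begin
    (length y ℕ.+ length x) ∸ (2 ℕ.* lcp y x)                ≡⟨ P.cong (λ t → (length y ℕ.+ length x) ∸ (2 ℕ.* t)) e ⟩
    (length y ℕ.+ length x) ∸ (length y ℕ.+ (length y ℕ.+ 0)) ≡⟨ ℕP.[m+n]∸[m+o]≡n∸o (length y) (length x) (length y ℕ.+ 0) ⟩
    length x ∸ (length y ℕ.+ 0)                               ≡⟨ P.cong (length x ∸_) (ℕP.+-identityʳ (length y)) ⟩
    length x ∸ length y                                       ∎
    where open P.≡-Reasoning

  dist-step : ∀ y y' x → length y' ≡ suc (length y) → lcp y' x ≡ lcp y x →
              dist y' x ≡ suc (dist y x)
  dist-step y y' x ey el rewrite ey | el = ℕP.+-∸-assoc 1 (2*lcp≤ y x)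

  dist-refl : ∀ x → dist x x ≡ 0
  dist-refl x = P.trans (dist-prefix x x (lcp-refl x)) (ℕP.n∸n≡0 (length x))

  dist-zero : ∀ y x → dist y x ≡ 0 → y ≡ x
  dist-zero y x e = lcp-full y x (ℕP.≤-antisym (lcp-≤ˡ y x) ly) (ℕP.≤-antisym (lcp-≤ʳ y x) lx)
    where
    l = lcp y x
    both : length y ℕ.+ length x ≤ l ℕ.+ l
    both = P.subst (length y ℕ.+ length x ≤_) (P.cong (l ℕ.+_) (ℕP.+-identityʳ l))
                   (ℕP.m∸n≡0⇒m≤n e)
    ly : length y ≤ l
    ly = ℕP.+-cancelʳ-≤ (length x) (length y) l
           (ℕP.≤-trans both (ℕP.+-monoʳ-≤ l (lcp-≤ʳ y x)))
    lx : length x ≤ l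
    lx = ℕP.+-cancelˡ-≤ (length y) (length x) l
           (ℕP.≤-trans both (ℕP.+-monoˡ-≤ l (lcp-≤ˡ y x)))

  length-≤-dist : ∀ w x → length w ≤ dist w x ℕ.+ length x
  length-≤-dist w x = ℕP.+-cancelʳ-≤ (length x) _ _ (begin
    length w ℕ.+ length x                       ≤⟨ ℕP.m≤n+m∸n _ (2 ℕ.* lcp w x) ⟩
    2 ℕ.* lcp w x ℕ.+ dist w x                  ≤⟨ ℕP.+-monoˡ-≤ (dist w x) (ℕP.*-monoʳ-≤ 2 (lcp-≤ʳ w x)) ⟩
    2 ℕ.* length x ℕ.+ dist w x                 ≡⟨ ℕP.+-comm (2 ℕ.* length x) (dist w x) ⟩
    dist w x ℕ.+ (length x ℕ.+ (length x ℕ.+ 0)) ≡⟨ P.sym (ℕP.+-assoc (dist w x) _ _) ⟩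
    (dist w x ℕ.+ length x) ℕ.+ (length x ℕ.+ 0) ≡⟨ P.cong ((dist w x ℕ.+ length x) ℕ.+_) (ℕP.+-identityʳ (length x)) ⟩
    (dist w x ℕ.+ length x) ℕ.+ length x        ∎)
    where open ℕP.≤-Reasoning

  dist≡ᵇ0 : ∀ w x → (dist w x ≡ᵇ 0) ≡ (w == x)
  dist≡ᵇ0 w x with w == x in e
  ... | true rewrite ==⇒≡ w x e | dist-refl x = P.refl
  ... | false with dist w x ≡ᵇ 0 in e′
  ...   | false = P.refl
  ...   | true = ⊥-elim (true≢false (P.trans (P.sym (==-refl x))
                   (P.subst (λ v → (v == x) ≡ false) (dist-zero w x (≡ᵇ⇒≡ e′)) e)))
    where
    true≢false : true ≢ false
    true≢false ()

  lcp-toward : ∀ y a x → (next y x ≐ a) ≡ true → lcp (y ++ [ a ]) x ≡ length (y ++ [ a ])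
  lcp-toward y a x eq = begin
    lcp (y ++ [ a ]) x             ≡⟨ lcp-snoc y a x ⟩
    lcp y x ℕ.+ bit (next y x ≐ a) ≡⟨ P.cong₂ (λ s t → s ℕ.+ bit t) y-prefix eq ⟩
    length y ℕ.+ 1                 ≡⟨ ℕP.+-comm (length y) 1 ⟩
    suc (length y)                 ≡⟨ P.sym (length-snoc y a) ⟩
    length (y ++ [ a ])            ∎
    where
    open P.≡-Reasoning
    y-prefix : lcp y x ≡ length y
    y-prefix = proj₁ (next-just y x a (≐⇒≡ _ a eq))

  lcp-away : ∀ y a x → (next y x ≐ a) ≡ false → lcp (y ++ [ a ]) x ≡ lcp y x
  lcp-away y a x eq =
    P.trans (lcp-snoc y a x) (P.trans (P.cong (λ t → lcp y x ℕ.+ bit t) eq) (ℕP.+-identityʳ _))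

  dist-child : ∀ y a x →
    dist (y ++ [ a ]) x ≡ (if next y x ≐ a then ℕ.pred (dist y x) else suc (dist y x))
  dist-child y a x with next y x ≐ a in eq
  ... | true = begin
    dist (y ++ [ a ]) x            ≡⟨ dist-prefix (y ++ [ a ]) x (lcp-toward y a x eq) ⟩
    length x ∸ length (y ++ [ a ]) ≡⟨ P.cong (length x ∸_) (length-snoc y a) ⟩
    length x ∸ suc (length y)      ≡⟨ P.sym (ℕP.pred[m∸n]≡m∸[1+n] (length x) (length y)) ⟩
    ℕ.pred (length x ∸ length y)   ≡⟨ P.cong ℕ.pred (P.sym (dist-prefix y x y-prefix)) ⟩
    ℕ.pred (dist y x)              ∎
    where
    open P.≡-Reasoning
    y-prefix : lcp y x ≡ length y
    y-prefix = proj₁ (next-just y x a (≐⇒≡ _ a eq))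
  ... | false = dist-step y (y ++ [ a ]) x (length-snoc y a) (lcp-away y a x eq)

  -- Seen from x, a word y = p ++ [ b ] is x itself, or lies strictly on the
  -- path from the root to x (then its parent p is one step farther from x),
  -- or lies off that path (then p is one step closer to x).
  data ParentPosition (y p x : Word) : Set where
    at-x : dist p x ≡ 1 → dist y x ≡ 0 → is-just (next y x) ≡ false → ParentPosition y p x
    on-path-to-x : ∀ m → dist p x ≡ suc (suc m) → dist y x ≡ suc m → is-just (next y x) ≡ true →
                ParentPosition y p x
    off-path-to-x : dist y x ≡ suc (dist p x) → is-just (next y x) ≡ false → ParentPosition y p x

  parent-position : ∀ p b x → ParentPosition (p ++ [ b ]) p x
  parent-position p b x with next p x ≐ b in eq
  ... | true = on-geodesic (next y x) P.refl
    where
    open P.≡-Reasoning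
    y = p ++ [ b ]
    p-prefix : lcp p x ≡ length p
    p-prefix = proj₁ (next-just p x b (≐⇒≡ _ b eq))
    p<x : length p < length x
    p<x = proj₂ (next-just p x b (≐⇒≡ _ b eq))
    dist-y : dist y x ≡ length x ∸ length y
    dist-y = dist-prefix y x (lcp-toward p b x eq)
    dist-p : dist p x ≡ suc (dist y x)
    dist-p = begin
      dist p x                  ≡⟨ dist-prefix p x p-prefix ⟩
      length x ∸ length p       ≡⟨ ℕP.+-∸-assoc 1 p<x ⟩
      suc (length x ∸ suc (length p)) ≡⟨ P.cong (λ t → suc (length x ∸ t)) (P.sym (length-snoc p b)) ⟩
      suc (length x ∸ length y) ≡⟨ P.cong suc (P.sym dist-y) ⟩
      suc (dist y x)            ∎
    on-geodesic : ∀ e → next y x ≡ e → ParentPosition y p x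
    on-geodesic nothing ne = at-x (P.trans dist-p (P.cong suc dist-y=0)) dist-y=0 (P.cong is-just ne)
      where
      dist-y=0 : dist y x ≡ 0
      dist-y=0 = P.trans dist-y
        (ℕP.m≤n⇒m∸n≡0 (next-nothing y x (lcp-toward p b x eq) ne))
    on-geodesic (just a) ne =
      on-path-to-x (length x ∸ suc (length y)) (P.trans dist-p (P.cong suc dist-y′)) dist-y′ (P.cong is-just ne)
      where
      dist-y′ : dist y x ≡ suc (length x ∸ suc (length y))
      dist-y′ = P.trans dist-y (ℕP.+-∸-assoc 1 (proj₂ (next-just y x a ne)))
  ... | false = off-geodesic (next y x) P.refl
    where
    y = p ++ [ b ]
    off-geodesic : ∀ e → next y x ≡ e → ParentPosition y p x
    off-geodesic nothing ne = off-path-to-x (dist-step p y x (length-snoc p b) (lcp-away p b x eq)) (P.cong is-just ne)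
    off-geodesic (just a) ne = ⊥-elim (ℕP.<-irrefl P.refl (begin-strict
      length y           ≡⟨ P.sym (proj₁ (next-just y x a ne)) ⟩
      lcp y x            ≡⟨ lcp-away p b x eq ⟩
      lcp p x            ≤⟨ lcp-≤ˡ p x ⟩
      length p           <⟨ ℕP.n<1+n (length p) ⟩
      suc (length p)     ≡⟨ P.sym (length-snoc p b) ⟩
      length y           ∎))
      where open ℕP.≤-Reasoning

-- Sums over the vertices of the tree, rewritten as sums over the list of
-- all words of length ≤ B with integer weights.  Double counting the
-- edges of the tree then becomes the symmetry of the adjacency
-- multiplicities (multiplicity-sym).
module BallSums {c ℓ : Level} (k : ℕ) (R : CommutativeRing c ℓ) where
  open CommutativeRing R
  open IntegerCoefficients R using (solve; _:=_; _:*_)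
  open ListSums R
  open Tree k
  open Words k
  open import Relation.Binary.Reasoning.Setoid setoid

  wordsUpTo : ℕ → List Word
  wordsUpTo B = concatMap wordsOfLength (upTo (suc B))

  candidates : Word → List Word
  candidates w = parentCand w ++ map (λ a → w ++ [ a ]) (allFin k)

  multiplicity : Word → List Word → Carrier
  multiplicity w L = ∑ L (λ u → 𝟙 (w == u))

  wordsOfLength-length : ∀ n → All (λ w → length w ≡ n) (wordsOfLength n)
  wordsOfLength-length zero = P.refl ∷ []
  wordsOfLength-length (suc n) =
    All.concat⁺ (All.map⁺ {f = λ b → map (b ∷_) (wordsOfLength n)} (All.tabulate⁺ {f = λ b → b}
      (λ b → All.map⁺ {f = b ∷_} (All-map (P.cong suc) (wordsOfLength-length n)))))

  upTo-< : ∀ n → All (_< n) (upTo n)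
  upTo-< n = All.applyUpTo⁺₁ (λ i → i) n (λ i<n → i<n)

  wordsUpTo-length : ∀ B → All (λ w → length w ≤ B) (wordsUpTo B)
  wordsUpTo-length B = All.concat⁺ (All.map⁺ (All-map {Q = λ i → All _ (wordsOfLength i)}
    (λ {i} i<1+B → All-map (λ e → P.subst (_≤ B) (P.sym e) (ℕP.≤-pred i<1+B)) (wordsOfLength-length i))
    (upTo-< (suc B))))

  candidates-length : ∀ z B → suc (length z) ≤ B → All (λ u → length u ≤ B) (candidates z)
  candidates-length z B le = All.++⁺ (parent z le)
    (All.map⁺ (All.tabulate⁺ (λ a → P.subst (_≤ B) (P.sym (length-snoc z a)) le)))
    where
    parent : ∀ w → suc (length w) ≤ B → All (λ u → length u ≤ B) (parentCand w)
    parent [] _ = []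
    parent (a ∷ w) l = P.subst (_≤ B) (ℕP.suc-injective (length-parent a w)) (ℕP.m+n≤o⇒n≤o 2 l) ∷ []

  ∑-upTo-suc : ∀ n (F : ℕ → Carrier) → ∑ (upTo (suc n)) F ≈ ∑ (upTo n) F + F n
  ∑-upTo-suc n F = begin
    ∑ (upTo (suc n)) F       ≡⟨ P.cong (λ L → ∑ L F) (P.sym (upTo-∷ʳ n)) ⟩
    ∑ (upTo n ++ [ n ]) F    ≈⟨ ∑-++ (upTo n) [ n ] F ⟩
    ∑ (upTo n) F + (F n + 0#) ≈⟨ +-congˡ (+-identityʳ (F n)) ⟩
    ∑ (upTo n) F + F n       ∎

  ∑-upTo-delta : ∀ n j X → j < n → ∑ (upTo n) (λ i → if i ≡ᵇ j then X else 0#) ≈ X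
  ∑-upTo-delta (suc n) j X (s≤s j≤n) with ℕP.m≤n⇒m<n∨m≡n j≤n
  ... | inj₁ j<n = begin
    ∑ (upTo (suc n)) δ                ≈⟨ ∑-upTo-suc n δ ⟩
    ∑ (upTo n) δ + δ n                ≈⟨ +-cong (∑-upTo-delta n j X j<n) (reflexive (P.cong (λ t → if t then X else 0#) n≢j)) ⟩
    X + 0#                            ≈⟨ +-identityʳ X ⟩
    X                                 ∎
    where
    δ = λ i → if i ≡ᵇ j then X else 0#
    n≢j = ≢⇒≡ᵇ-false (λ n≡j → ℕP.<⇒≢ j<n (P.sym n≡j))
  ... | inj₂ P.refl = begin
    ∑ (upTo (suc n)) δ                ≈⟨ ∑-upTo-suc n δ ⟩
    ∑ (upTo n) δ + δ n                ≈⟨ +-cong below-n (reflexive (P.cong (λ t → if t then X else 0#) (≡ᵇ-refl n))) ⟩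
    0# + X                            ≈⟨ +-identityˡ X ⟩
    X                                 ∎
    where
    δ = λ i → if i ≡ᵇ n then X else 0#
    below-n : ∑ (upTo n) δ ≈ 0#
    below-n = trans
      (∑-cong-All (upTo n) (upTo-< n)
         (λ i i<n → reflexive (P.cong (λ t → if t then X else 0#) (≢⇒≡ᵇ-false (ℕP.<⇒≢ i<n)))))
      (∑-zero (upTo n) (λ _ → refl))

  ∑-wordsOfLength-suc : ∀ n h →
    ∑ (wordsOfLength (suc n)) h ≈ ∑ (allFin k) (λ b → ∑ (wordsOfLength n) (λ w → h (b ∷ w)))
  ∑-wordsOfLength-suc n h =
    trans (∑-concatMap (allFin k) (λ b → map (b ∷_) (wordsOfLength n)) h)
          (∑-cong (allFin k) (λ b → ∑-map (wordsOfLength n) (b ∷_) h))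

  ∑-wordsOfLength-delta : ∀ n a (h : Word → Carrier) →
    ∑ (wordsOfLength n) (λ w → 𝟙 (w == a) * h w) ≈ (if n ≡ᵇ length a then h a else 0#)
  ∑-wordsOfLength-delta zero [] h = trans (+-identityʳ _) (*-identityˡ _)
  ∑-wordsOfLength-delta zero (c ∷ a) h = trans (+-identityʳ _) (zeroˡ _)
  ∑-wordsOfLength-delta (suc n) [] h = trans (∑-wordsOfLength-suc n _)
    (∑-zero (allFin k) (λ b → ∑-zero (wordsOfLength n) (λ w → zeroˡ _)))
  ∑-wordsOfLength-delta (suc n) (c ∷ a) h = begin
    _  ≈⟨ ∑-wordsOfLength-suc n _ ⟩
    ∑ (allFin k) (λ b → ∑ (wordsOfLength n) (λ w → 𝟙 ((b ∷ w) == (c ∷ a)) * h (b ∷ w)))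
       ≈⟨ ∑-cong (allFin k) first-letter ⟩
    ∑ (allFin k) (λ b → if ⌊ b ≟ᶠ c ⌋ then ∑ (wordsOfLength n) (λ w → 𝟙 (w == a) * h (b ∷ w)) else 0#)
       ≈⟨ ∑-delta c (λ b → ∑ (wordsOfLength n) (λ w → 𝟙 (w == a) * h (b ∷ w))) ⟩
    ∑ (wordsOfLength n) (λ w → 𝟙 (w == a) * h (c ∷ w))
       ≈⟨ ∑-wordsOfLength-delta n a (λ w → h (c ∷ w)) ⟩
    (if n ≡ᵇ length a then h (c ∷ a) else 0#) ∎
    where
    first-letter : ∀ b → ∑ (wordsOfLength n) (λ w → 𝟙 ((b ∷ w) == (c ∷ a)) * h (b ∷ w))
      ≈ (if ⌊ b ≟ᶠ c ⌋ then ∑ (wordsOfLength n) (λ w → 𝟙 (w == a) * h (b ∷ w)) else 0#)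
    first-letter b with ⌊ b ≟ᶠ c ⌋
    ... | true = refl
    ... | false = ∑-zero (wordsOfLength n) (λ w → zeroˡ _)

  ∑-wordsUpTo-delta : ∀ B a (h : Word → Carrier) → length a ≤ B →
    ∑ (wordsUpTo B) (λ w → 𝟙 (w == a) * h w) ≈ h a
  ∑-wordsUpTo-delta B a h le = begin
    ∑ (wordsUpTo B) (λ w → 𝟙 (w == a) * h w)
      ≈⟨ ∑-concatMap (upTo (suc B)) wordsOfLength _ ⟩
    ∑ (upTo (suc B)) (λ n → ∑ (wordsOfLength n) (λ w → 𝟙 (w == a) * h w))
      ≈⟨ ∑-cong (upTo (suc B)) (λ n → ∑-wordsOfLength-delta n a h) ⟩
    ∑ (upTo (suc B)) (λ n → if n ≡ᵇ length a then h a else 0#)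
      ≈⟨ ∑-upTo-delta (suc B) (length a) (h a) (s≤s le) ⟩
    h a ∎

  ∑-by-multiplicity : ∀ B (L : List Word) (h : Word → Carrier) → All (λ u → length u ≤ B) L →
    ∑ L h ≈ ∑ (wordsUpTo B) (λ w → multiplicity w L * h w)
  ∑-by-multiplicity B [] h [] = sym (∑-zero (wordsUpTo B) (λ w → zeroˡ _))
  ∑-by-multiplicity B (u ∷ L) h (u≤B ∷ L≤B) = begin
    h u + ∑ L h
      ≈⟨ +-cong (sym (∑-wordsUpTo-delta B u h u≤B)) (∑-by-multiplicity B L h L≤B) ⟩
    ∑ (wordsUpTo B) (λ w → 𝟙 (w == u) * h w) + ∑ (wordsUpTo B) (λ w → multiplicity w L * h w)
      ≈⟨ sym (∑-+ (wordsUpTo B) _ _) ⟩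
    ∑ (wordsUpTo B) (λ w → 𝟙 (w == u) * h w + multiplicity w L * h w)
      ≈⟨ ∑-cong (wordsUpTo B) (λ w → sym (distribʳ (h w) _ _)) ⟩
    ∑ (wordsUpTo B) (λ w → multiplicity w (u ∷ L) * h w) ∎

  isParentOf : Word → Word → Bool
  isParentOf y [] = false
  isParentOf y (c ∷ q) = y == dropLast (c ∷ q)

  multiplicity-children : ∀ y z →
    ∑ (allFin k) (λ a → 𝟙 (y == (z ++ [ a ]))) ≈ 𝟙 (isParentOf z y)
  multiplicity-children [] z = ∑-zero (allFin k) (λ a → reflexive (P.cong 𝟙 ([]≠snoc z a)))
  multiplicity-children (c ∷ q) z = begin
    ∑ (allFin k) (λ a → 𝟙 ((c ∷ q) == (z ++ [ a ])))  ≈⟨ ∑-cong (allFin k) split ⟩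
    ∑ (allFin k) (λ a → 𝟙 ((z == p) ∧ ⌊ a ≟ᶠ b ⌋))   ≈⟨ count (z == p) ⟩
    𝟙 (z == p)                                        ∎
    where
    p = dropLast (c ∷ q)
    b = lastOf c q
    split : ∀ a → 𝟙 ((c ∷ q) == (z ++ [ a ])) ≈ 𝟙 ((z == p) ∧ ⌊ a ≟ᶠ b ⌋)
    split a = reflexive (P.cong 𝟙 (P.trans (P.cong (_== (z ++ [ a ])) (P.sym (parent++last c q)))
                (P.trans (==-snoc p z b a) (P.cong₂ _∧_ (==-sym p z) (≟ᶠ-sym b a)))))
    count : ∀ t → ∑ (allFin k) (λ a → 𝟙 (t ∧ ⌊ a ≟ᶠ b ⌋)) ≈ 𝟙 t
    count true = ∑-delta b (λ _ → 1#)
    count false = ∑-zero (allFin k) (λ _ → refl)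

  multiplicity-candidates : ∀ y z →
    multiplicity y (candidates z) ≈ 𝟙 (isParentOf y z) + 𝟙 (isParentOf z y)
  multiplicity-candidates y z = trans (∑-++ (parentCand z) _ _)
    (+-cong (parent z) (trans (∑-map (allFin k) (λ a → z ++ [ a ]) _) (multiplicity-children y z)))
    where
    parent : ∀ z → multiplicity y (parentCand z) ≈ 𝟙 (isParentOf y z)
    parent [] = refl
    parent (a ∷ z) = +-identityʳ _

  multiplicity-sym : ∀ y z → multiplicity y (candidates z) ≈ multiplicity z (candidates y)
  multiplicity-sym y z = trans (multiplicity-candidates y z)
    (trans (+-comm _ _) (sym (multiplicity-candidates z y)))

  ∑-wordsUpTo-suc : ∀ B h →
    ∑ (wordsUpTo (suc B)) h ≈ ∑ (wordsUpTo B) h + ∑ (wordsOfLength (suc B)) h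
  ∑-wordsUpTo-suc B h = trans (∑-concatMap (upTo (suc (suc B))) wordsOfLength h)
    (trans (∑-upTo-suc (suc B) _) (+-congʳ (sym (∑-concatMap (upTo (suc B)) wordsOfLength h))))

  ∑-wordsUpTo-extend : ∀ B B′ h → B ≤ B′ → (∀ w → B < length w → h w ≈ 0#) →
    ∑ (wordsUpTo B) h ≈ ∑ (wordsUpTo B′) h
  ∑-wordsUpTo-extend B B′ h le vanish = go B′ (ℕP.≤⇒≤′ le)
    where
    go : ∀ B′ → B ℕ.≤′ B′ → ∑ (wordsUpTo B) h ≈ ∑ (wordsUpTo B′) h
    go _ ℕ.≤′-refl = refl
    go (suc B′) (ℕ.≤′-step le′) = begin
      ∑ (wordsUpTo B) h                                         ≈⟨ go B′ le′ ⟩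
      ∑ (wordsUpTo B′) h                                        ≈⟨ sym (+-identityʳ _) ⟩
      ∑ (wordsUpTo B′) h + 0#                                   ≈⟨ +-congˡ (sym new-layer) ⟩
      ∑ (wordsUpTo B′) h + ∑ (wordsOfLength (suc B′)) h         ≈⟨ sym (∑-wordsUpTo-suc B′ h) ⟩
      ∑ (wordsUpTo (suc B′)) h                                  ∎
      where
      new-layer : ∑ (wordsOfLength (suc B′)) h ≈ 0#
      new-layer = trans
        (∑-cong-All (wordsOfLength (suc B′)) {g = λ _ → 0#} (wordsOfLength-length (suc B′))
          (λ w e → vanish w (P.subst (B <_) (P.sym e) (s≤s (ℕP.≤′⇒≤ le′)))))
        (∑-zero (wordsOfLength (suc B′)) (λ _ → refl))

  double-count : ∀ B (a b : Word → Carrier) → (∀ z → B ≤ length z → a z ≈ 0#) →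
    ∑ (wordsUpTo (suc B)) (λ z → a z * ∑ (candidates z) b)
      ≈ ∑ (wordsUpTo B) (λ w → ∑ (candidates w) a * b w)
  double-count B a b vanish = begin
    ∑ (wordsUpTo (suc B)) (λ z → a z * ∑ (candidates z) b)
      ≈⟨ ∑-cong (wordsUpTo (suc B)) expand ⟩
    ∑ (wordsUpTo (suc B)) (λ z → a z * ∑ (wordsUpTo B) (λ w → multiplicity w (candidates z) * b w))
      ≈⟨ ∑-cong (wordsUpTo (suc B)) (λ z → sym (∑-*ˡ (wordsUpTo B) (a z) _)) ⟩
    ∑ (wordsUpTo (suc B)) (λ z → ∑ (wordsUpTo B) (λ w → a z * (multiplicity w (candidates z) * b w)))
      ≈⟨ ∑-swap (wordsUpTo (suc B)) (wordsUpTo B) _ ⟩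
    ∑ (wordsUpTo B) (λ w → ∑ (wordsUpTo (suc B)) (λ z → a z * (multiplicity w (candidates z) * b w)))
      ≈⟨ ∑-cong (wordsUpTo B) (λ w → trans (∑-cong (wordsUpTo (suc B)) (λ z → rearrange w z))
                                          (∑-*ʳ (wordsUpTo (suc B)) (b w) _)) ⟩
    ∑ (wordsUpTo B) (λ w → ∑ (wordsUpTo (suc B)) (λ z → multiplicity z (candidates w) * a z) * b w)
      ≈⟨ ∑-cong-All (wordsUpTo B) (wordsUpTo-length B) (λ w w≤B → *-congʳ (sym
           (∑-by-multiplicity (suc B) (candidates w) a (candidates-length w (suc B) (s≤s w≤B))))) ⟩
    ∑ (wordsUpTo B) (λ w → ∑ (candidates w) a * b w) ∎
    where
    expand : ∀ z → a z * ∑ (candidates z) b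
                 ≈ a z * ∑ (wordsUpTo B) (λ w → multiplicity w (candidates z) * b w)
    expand z with length z ℕP.<? B
    ... | yes z<B = *-congˡ (∑-by-multiplicity B (candidates z) b (candidates-length z B z<B))
    ... | no z≮B = trans (*-congʳ (vanish z (ℕP.≮⇒≥ z≮B)))
                         (trans (zeroˡ _) (sym (trans (*-congʳ (vanish z (ℕP.≮⇒≥ z≮B))) (zeroˡ _))))
    rearrange : ∀ w z → a z * (multiplicity w (candidates z) * b w)
                      ≈ (multiplicity z (candidates w) * a z) * b w
    rearrange w z = trans (*-congˡ (*-congʳ (multiplicity-sym w z)))
      (solve 3 (λ a m b → a :* (m :* b) := (m :* a) :* b) refl _ _ _)

module NeighbourCount {c ℓ : Level} (k₁ : ℕ) (R : CommutativeRing c ℓ) where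
  k : ℕ
  k = suc k₁
  open CommutativeRing R
  open Scalars R using (ι)
  open import Algebra.Properties.Ring ring using (-0#≈0#)
  open IntegerCoefficients R using (solve; _:=_; _:+_; _:-_)
  open ListSums R
  open Tree k
  open Words k
  open BallSums k R
  open import Relation.Binary.Reasoning.Setoid setoid

  -- the number of neighbours at distance r of a vertex at distance m
  neighboursAt : ℕ → ℕ → Carrier
  neighboursAt r zero = ι k * 𝟙 (1 ≡ᵇ r)
  neighboursAt r (suc m) = 𝟙 (m ≡ᵇ r) + ι k₁ * 𝟙 (suc (suc m) ≡ᵇ r)

  allowed : Word → Fin k → Bool
  allowed [] a = true
  allowed (c ∷ q) a = not ⌊ lastOf c q ≟ᶠ a ⌋

  reduced-child : ∀ y a → reducedᵇ y ≡ true → reducedᵇ (y ++ [ a ]) ≡ allowed y a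
  reduced-child [] a _ = P.refl
  reduced-child (c ∷ q) a y-red =
    P.trans (reduced-snoc c q a) (P.cong (_∧ not ⌊ lastOf c q ≟ᶠ a ⌋) y-red)

  ∑-≐ : ∀ e → ∑ (allFin k) (λ a → 𝟙 (e ≐ a)) ≈ 𝟙 (is-just e)
  ∑-≐ nothing = ∑-zero (allFin k) (λ _ → refl)
  ∑-≐ (just c) = ∑-delta c (λ _ → 1#)

  -- a child of a vertex at distance m lies at distance pred m (if it
  -- moves towards x) or suc m (otherwise); these are the two indicators
  away : ℕ → ℕ → Carrier
  away r m = 𝟙 (suc m ≡ᵇ r)

  towards : ℕ → ℕ → Carrier
  towards r m = 𝟙 (ℕ.pred m ≡ᵇ r) - away r m

  private
    k·q≈q+k₁·q : ∀ q → ι k * q ≈ q + ι k₁ * q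
    k·q≈q+k₁·q q = trans (distribʳ q 1# (ι k₁)) (+-congʳ (*-identityˡ q))

    drop-towards : ∀ {t q} → 0# * t + ι k * q ≈ q + ι k₁ * q
    drop-towards = trans (+-congʳ (zeroˡ _)) (trans (+-identityˡ _) (k·q≈q+k₁·q _))

  -- the count around the root, whose k children are all reduced
  root-count : ∀ r x → 𝟙 (is-just (next [] x)) * towards r (dist [] x) + ι k * away r (dist [] x)
                       ≈ neighboursAt r (dist [] x)
  root-count r [] = trans (+-congʳ (zeroˡ _)) (+-identityˡ _)
  root-count r (c ∷ x) = begin
    1# * (p - q) + ι k * q   ≈⟨ +-cong (*-identityˡ _) (k·q≈q+k₁·q q) ⟩
    (p - q) + (q + ι k₁ * q) ≈⟨ solve 3 (λ p q s → (p :- q) :+ (q :+ s) := p :+ s) refl p q (ι k₁ * q) ⟩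
    p + ι k₁ * q             ∎
    where
    p = 𝟙 (length x ≡ᵇ r)
    q = 𝟙 (suc (suc (length x)) ≡ᵇ r)

  -- the count around a nonempty word y with parent p: the parent, plus the
  -- k - 1 children other than the one repeating the last letter
  nonroot-count : ∀ r y p x → ParentPosition y p x →
    𝟙 (dist p x ≡ᵇ r) + (𝟙 (is-just (next y x)) * towards r (dist y x) + ι k * away r (dist y x)
                          - away r (dist y x))
      ≈ neighboursAt r (dist y x)
  nonroot-count r y p x (at-x dp dy J) rewrite dp | dy | J = begin
    q + (0# * towards r 0 + ι k * q - q) ≈⟨ +-congˡ (+-congʳ drop-towards) ⟩
    q + ((q + ι k₁ * q) - q)          ≈⟨ solve 2 (λ q s → q :+ ((q :+ s) :- q) := q :+ s) refl q (ι k₁ * q) ⟩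
    q + ι k₁ * q                      ≈⟨ sym (k·q≈q+k₁·q q) ⟩
    ι k * q                           ∎
    where q = 𝟙 (1 ≡ᵇ r)
  nonroot-count r y p x (on-path-to-x m dp dy J) rewrite dp | dy | J = begin
    q + (1# * (p′ - q) + ι k * q - q) ≈⟨ +-congˡ (+-congʳ (+-cong (*-identityˡ _) (k·q≈q+k₁·q q))) ⟩
    q + ((p′ - q) + (q + ι k₁ * q) - q) ≈⟨ solve 3 (λ q p′ s → q :+ (((p′ :- q) :+ (q :+ s)) :- q) := p′ :+ s) refl q p′ (ι k₁ * q) ⟩
    p′ + ι k₁ * q                     ∎
    where
    p′ = 𝟙 (m ≡ᵇ r)
    q = 𝟙 (suc (suc m) ≡ᵇ r)
  nonroot-count r y p x (off-path-to-x dy J) rewrite dy | J = begin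
    p′ + (0# * (p′ - q) + ι k * q - q) ≈⟨ +-congˡ (+-congʳ drop-towards) ⟩
    p′ + ((q + ι k₁ * q) - q)         ≈⟨ solve 3 (λ p′ q s → p′ :+ ((q :+ s) :- q) := p′ :+ s) refl p′ q (ι k₁ * q) ⟩
    p′ + ι k₁ * q                     ∎
    where
    p′ = 𝟙 (dist p x ≡ᵇ r)
    q = 𝟙 (suc (suc (dist p x)) ≡ᵇ r)

  module From (x : Word) (x-reduced : reducedᵇ x ≡ true) where

    onSphere : ℕ → Word → Carrier
    onSphere r z = 𝟙 (reducedᵇ z ∧ (dist z x ≡ᵇ r))

    module Children (y : Word) (r : ℕ) where
      m = dist y x

      childTerm : Fin k → Carrier
      childTerm a = 𝟙 (next y x ≐ a) * towards r m + away r m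

      onSphere-child : ∀ a → reducedᵇ y ≡ true →
        onSphere r (y ++ [ a ]) ≈ 𝟙 (allowed y a) * childTerm a
      onSphere-child a y-red = trans
        (reflexive (P.cong₂ (λ s t → 𝟙 (s ∧ (t ≡ᵇ r))) (reduced-child y a y-red) (dist-child y a x)))
        (split (allowed y a) (next y x ≐ a))
        where
        split : ∀ ρ J → 𝟙 (ρ ∧ ((if J then ℕ.pred m else suc m) ≡ᵇ r))
                        ≈ 𝟙 ρ * (𝟙 J * towards r m + away r m)
        split false J = sym (zeroˡ _)
        split true true = sym (trans (*-identityˡ _) (trans (+-congʳ (*-identityˡ _))
          (solve 2 (λ p q → (p :- q) :+ q := p) refl _ _)))
        split true false = sym (trans (*-identityˡ _) (trans (+-congʳ (zeroˡ _)) (+-identityˡ _)))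

      ∑-childTerm : ∑ (allFin k) childTerm ≈ 𝟙 (is-just (next y x)) * towards r m + ι k * away r m
      ∑-childTerm = trans (∑-+ (allFin k) _ _)
        (+-cong (trans (∑-*ʳ (allFin k) (towards r m) _) (*-congʳ (∑-≐ (next y x))))
                (∑-allFin-const k (away r m)))

      ∑-children : ∑ (map (λ a → y ++ [ a ]) (allFin k)) (onSphere r)
                   ≈ ∑ (allFin k) (λ a → onSphere r (y ++ [ a ]))
      ∑-children = ∑-map (allFin k) (λ a → y ++ [ a ]) (onSphere r)

    -- around the root all k children are reduced
    ∑-children-root : ∀ r → ∑ (allFin k) (λ a → onSphere r ([] ++ [ a ]))
      ≈ 𝟙 (is-just (next [] x)) * towards r (dist [] x) + ι k * away r (dist [] x)
    ∑-children-root r = trans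
      (∑-cong (allFin k) (λ a → trans (onSphere-child a P.refl) (*-identityˡ _))) ∑-childTerm
      where open Children [] r

    -- the child repeating the last letter b is missing; it would have lain
    -- one step farther from x
    ∑-children-nonroot : ∀ r c q → reducedᵇ (c ∷ q) ≡ true →
      ∑ (allFin k) (λ a → onSphere r ((c ∷ q) ++ [ a ]))
        ≈ 𝟙 (is-just (next (c ∷ q) x)) * towards r (dist (c ∷ q) x)
          + ι k * away r (dist (c ∷ q) x) - away r (dist (c ∷ q) x)
    ∑-children-nonroot r c q y-red = begin
      ∑ (allFin k) (λ a → onSphere r ((c ∷ q) ++ [ a ]))
        ≈⟨ ∑-cong (allFin k) (λ a → trans (onSphere-child a y-red) (drop-b a)) ⟩
      ∑ (allFin k) (λ a → childTerm a - (if ⌊ a ≟ᶠ b ⌋ then childTerm a else 0#))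
        ≈⟨ ∑-- (allFin k) _ _ ⟩
      ∑ (allFin k) childTerm - ∑ (allFin k) (λ a → if ⌊ a ≟ᶠ b ⌋ then childTerm a else 0#)
        ≈⟨ +-cong ∑-childTerm (-‿cong (trans (∑-delta b childTerm) childTerm-b)) ⟩
      𝟙 (is-just (next (c ∷ q) x)) * towards r m + ι k * away r m - away r m ∎
      where
      open Children (c ∷ q) r
      b = lastOf c q
      drop-b : ∀ a → 𝟙 (allowed (c ∷ q) a) * childTerm a
                   ≈ childTerm a - (if ⌊ a ≟ᶠ b ⌋ then childTerm a else 0#)
      drop-b a rewrite ≟ᶠ-sym b a with ⌊ a ≟ᶠ b ⌋
      ... | true = trans (zeroˡ _) (sym (-‿inverseʳ _))
      ... | false = trans (*-identityˡ _) (sym (trans (+-congˡ -0#≈0#) (+-identityʳ _)))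
      childTerm-b : childTerm b ≈ away r m
      childTerm-b = trans (+-congʳ (trans (*-congʳ (reflexive (P.cong 𝟙 (next-not-last c q x x-reduced))))
                                          (zeroˡ _)))
                          (+-identityˡ _)

    neighbour-count : ∀ r y → reducedᵇ y ≡ true →
      ∑ (candidates y) (onSphere r) ≈ neighboursAt r (dist y x)
    neighbour-count r [] _ = trans (Children.∑-children [] r)
      (trans (∑-children-root r) (root-count r x))
    neighbour-count r (c ∷ q) y-red = begin
      onSphere r p + ∑ (map (λ a → (c ∷ q) ++ [ a ]) (allFin k)) (onSphere r)
        ≈⟨ +-cong parent-reduced (trans (Children.∑-children (c ∷ q) r)
                                       (∑-children-nonroot r c q y-red)) ⟩
      𝟙 (dist p x ≡ᵇ r) + (𝟙 (is-just (next (c ∷ q) x)) * towards r (dist (c ∷ q) x)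
          + ι k * away r (dist (c ∷ q) x) - away r (dist (c ∷ q) x))
        ≈⟨ nonroot-count r (c ∷ q) p x position ⟩
      neighboursAt r (dist (c ∷ q) x) ∎
      where
      p = dropLast (c ∷ q)
      parent-reduced : onSphere r p ≈ 𝟙 (dist p x ≡ᵇ r)
      parent-reduced = reflexive (P.cong (λ s → 𝟙 (s ∧ (dist p x ≡ᵇ r))) (reduced-parent c q y-red))
      position : ParentPosition (c ∷ q) p x
      position = P.subst (λ y → ParentPosition y p x) (parent++last c q)
                         (parent-position p (lastOf c q) x)

module SphereSums {c ℓ : Level} (k₁ : ℕ) (R : CommutativeRing c ℓ) where
  open NeighbourCount k₁ R
  open CommutativeRing R
  open Scalars R using (ι)
  open ListSums R
  open Tree k
  open Words k
  open BallSums k R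
  open import Relation.Binary.Reasoning.Setoid setoid

  toVertex-reduced : ∀ w (p : T (reducedᵇ w)) → toVertex w ≡ just (w , p)
  toVertex-reduced w p with T? (reducedᵇ w)
  ... | yes p′ = P.cong (λ t → just (w , t)) (T-irrelevant p′ p)
  ... | no ¬p = ⊥-elim (¬p p)

  toVertex-nonreduced : ∀ w → reducedᵇ w ≡ false → toVertex w ≡ nothing
  toVertex-nonreduced w e with T? (reducedᵇ w)
  ... | yes p = ⊥-elim (false≢true (P.trans (P.sym e) (T⇒≡true p)))
    where
    false≢true : false ≢ true
    false≢true ()
  ... | no _ = P.refl

  extend : (Vertex → Carrier) → Word → Carrier
  extend g w = maybe g 0# (toVertex w)

  extend-vertex : ∀ g (v : Vertex) → extend g (proj₁ v) ≈ g v
  extend-vertex g v = reflexive (P.cong (maybe g 0#) (toVertex-reduced (proj₁ v) (proj₂ v)))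

  extend-reduced : ∀ g w (w-red : reducedᵇ w ≡ true) → extend g w ≈ g (w , ≡true⇒T w-red)
  extend-reduced g w w-red = reflexive (P.cong (maybe g 0#) (toVertex-reduced w (≡true⇒T w-red)))

  extend-guard : ∀ g w {X Y} → (reducedᵇ w ≡ true → X ≈ Y) → X * extend g w ≈ Y * extend g w
  extend-guard g w {X} {Y} X≈Y = by-cases (reducedᵇ w) P.refl
    where
    by-cases : ∀ b → reducedᵇ w ≡ b → X * extend g w ≈ Y * extend g w
    by-cases true e = *-congʳ (X≈Y e)
    by-cases false e = trans (*-congˡ vanish) (trans (zeroʳ X) (sym (trans (*-congˡ vanish) (zeroʳ Y))))
      where
      vanish : extend g w ≈ 0#
      vanish = reflexive (P.cong (maybe g 0#) (toVertex-nonreduced w e))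

  ∑-neighbours : ∀ (f : Vertex → Carrier) v → ∑ (neighbours v) f ≈ ∑ (candidates (proj₁ v)) (extend f)
  ∑-neighbours f v = ∑-mapMaybe (candidates (proj₁ v)) toVertex f

  -- a vertex of S(x, r+1) has branching r neighbours in S(x, r);
  -- equally, S(x, r+1) has branching r times as many vertices as S(x, r)
  branching : ℕ → ℕ
  branching zero = k
  branching (suc _) = k₁

  module Around (x : Vertex) where
    x′ = proj₁ x
    open From x′ (T⇒≡true (proj₂ x)) public

    onSphere-guard : ∀ r w {X Y} → (reducedᵇ w ≡ true → dist w x′ ≡ r → X ≈ Y) →
                     onSphere r w * X ≈ onSphere r w * Y
    onSphere-guard r w {X} {Y} X≈Y with reducedᵇ w ∧ (dist w x′ ≡ᵇ r) in e
    ... | true = *-congˡ (X≈Y (∧-trueˡ e) (≡ᵇ⇒≡ (∧-trueʳ {reducedᵇ w} e)))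
    ... | false = trans (zeroˡ X) (sym (zeroˡ Y))

    onSphere-reduced : ∀ r w → reducedᵇ w ≡ true → onSphere r w ≈ 𝟙 (dist w x′ ≡ᵇ r)
    onSphere-reduced r w w-red = reflexive (P.cong (λ s → 𝟙 (s ∧ (dist w x′ ≡ᵇ r))) w-red)

    onSphere-vanish : ∀ r w → length x′ ℕ.+ r < length w → onSphere r w ≈ 0#
    onSphere-vanish r w long = begin
      onSphere r w        ≈⟨ sym (*-identityʳ _) ⟩
      onSphere r w * 1#   ≈⟨ onSphere-guard r w (λ _ dist≡r → ⊥-elim (ℕP.<⇒≱ long (short dist≡r))) ⟩
      onSphere r w * 0#   ≈⟨ zeroʳ _ ⟩
      0#                  ∎
      where
      short : dist w x′ ≡ r → length w ≤ length x′ ℕ.+ r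
      short dist≡r = P.subst (length w ≤_) (P.trans (P.cong (ℕ._+ length x′) dist≡r) (ℕP.+-comm r _))
                             (length-≤-dist w x′)

    ∑-sphere : ∀ r g B → length x′ ℕ.+ r ≤ B →
      ∑ (sphere x r) g ≈ ∑ (wordsUpTo B) (λ w → onSphere r w * extend g w)
    ∑-sphere r g B le = begin
      ∑ (sphere x r) g
        ≈⟨ ∑-filter (ball (length x′ ℕ.+ r)) _ g ⟩
      ∑ (ball (length x′ ℕ.+ r)) (λ z → if ⌊ d z x ℕP.≟ r ⌋ then g z else 0#)
        ≈⟨ ∑-mapMaybe (wordsUpTo (length x′ ℕ.+ r)) toVertex _ ⟩
      ∑ (wordsUpTo (length x′ ℕ.+ r)) (λ w → maybe (λ z → if ⌊ d z x ℕP.≟ r ⌋ then g z else 0#) 0# (toVertex w))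
        ≈⟨ ∑-cong (wordsUpTo (length x′ ℕ.+ r)) (λ w → on-words w (reducedᵇ w) P.refl) ⟩
      ∑ (wordsUpTo (length x′ ℕ.+ r)) (λ w → onSphere r w * extend g w)
        ≈⟨ ∑-wordsUpTo-extend (length x′ ℕ.+ r) B _ le too-long ⟩
      ∑ (wordsUpTo B) (λ w → onSphere r w * extend g w) ∎
      where
      on-words : ∀ w b → reducedᵇ w ≡ b →
        maybe (λ z → if ⌊ d z x ℕP.≟ r ⌋ then g z else 0#) 0# (toVertex w) ≈ onSphere r w * extend g w
      on-words w true e = begin
        maybe G 0# (toVertex w)                        ≡⟨ P.cong (maybe G 0#) (toVertex-reduced w p) ⟩
        (if ⌊ dist w x′ ℕP.≟ r ⌋ then g (w , p) else 0#) ≡⟨ P.cong (λ t → if t then g (w , p) else 0#)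
                                                                  (⌊≟⌋≡≡ᵇ (dist w x′) r) ⟩
        (if dist w x′ ≡ᵇ r then g (w , p) else 0#)     ≈⟨ if-as-𝟙 (dist w x′ ≡ᵇ r) (g (w , p)) ⟩
        𝟙 (dist w x′ ≡ᵇ r) * g (w , p)                 ≈⟨ sym (*-cong (onSphere-reduced r w e) (extend-reduced g w e)) ⟩
        onSphere r w * extend g w                      ∎
        where
        G = λ z → if ⌊ d z x ℕP.≟ r ⌋ then g z else 0#
        p = ≡true⇒T e
      on-words w false e = begin
        maybe _ 0# (toVertex w)     ≡⟨ P.cong (maybe _ 0#) (toVertex-nonreduced w e) ⟩
        0#                          ≈⟨ sym (zeroˡ _) ⟩
        0# * extend g w             ≡⟨ P.cong (λ s → 𝟙 (s ∧ (dist w x′ ≡ᵇ r)) * extend g w) (P.sym e) ⟩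
        onSphere r w * extend g w   ∎
      too-long : ∀ w → length x′ ℕ.+ r < length w → onSphere r w * extend g w ≈ 0#
      too-long w long = trans (*-congʳ (onSphere-vanish r w long)) (zeroˡ _)

    sphere-0 : ∀ g → ∑ (sphere x 0) g ≈ g x
    sphere-0 g = begin
      ∑ (sphere x 0) g
        ≈⟨ ∑-sphere 0 g (length x′ ℕ.+ 0) ℕP.≤-refl ⟩
      ∑ (wordsUpTo (length x′ ℕ.+ 0)) (λ w → onSphere 0 w * extend g w)
        ≈⟨ ∑-cong (wordsUpTo (length x′ ℕ.+ 0)) (λ w → extend-guard g w (λ w-red →
             trans (onSphere-reduced 0 w w-red) (reflexive (P.cong 𝟙 (dist≡ᵇ0 w x′))))) ⟩
      ∑ (wordsUpTo (length x′ ℕ.+ 0)) (λ w → 𝟙 (w == x′) * extend g w)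
        ≈⟨ ∑-wordsUpTo-delta (length x′ ℕ.+ 0) x′ (extend g) (ℕP.m≤m+n (length x′) 0) ⟩
      extend g x′
        ≈⟨ extend-vertex g x ⟩
      g x ∎

    sphere-neighbours : ∀ r f →
      ∑ (sphere x r) (λ z → ∑ (neighbours z) f)
        ≈ ∑ (wordsUpTo (length x′ ℕ.+ suc r)) (λ w → neighboursAt r (dist w x′) * extend f w)
    sphere-neighbours r f = begin
      ∑ (sphere x r) N
        ≈⟨ ∑-sphere r N (suc B) (ℕP.≤-trans (ℕP.+-monoʳ-≤ (length x′) (ℕP.n≤1+n r)) (ℕP.n≤1+n B)) ⟩
      ∑ (wordsUpTo (suc B)) (λ z → onSphere r z * extend N z)
        ≈⟨ ∑-cong (wordsUpTo (suc B)) (λ z → onSphere-guard r z (λ z-red _ →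
             trans (extend-reduced N z z-red) (∑-neighbours f (z , ≡true⇒T z-red)))) ⟩
      ∑ (wordsUpTo (suc B)) (λ z → onSphere r z * ∑ (candidates z) (extend f))
        ≈⟨ double-count B (onSphere r) (extend f)
             (λ z B≤z → onSphere-vanish r z (P.subst (_≤ length z) (ℕP.+-suc (length x′) r) B≤z)) ⟩
      ∑ (wordsUpTo B) (λ w → ∑ (candidates w) (onSphere r) * extend f w)
        ≈⟨ ∑-cong (wordsUpTo B) (λ w → extend-guard f w (neighbour-count r w)) ⟩
      ∑ (wordsUpTo B) (λ w → neighboursAt r (dist w x′) * extend f w) ∎
      where
      B = length x′ ℕ.+ suc r
      N : Vertex → Carrier
      N z = ∑ (neighbours z) f

    -- the neighbours of x form the sphere of radius 1
    sphere-neighbours-0 : ∀ f → ∑ (sphere x 0) (λ z → ∑ (neighbours z) f) ≈ ∑ (sphere x 1) f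
    sphere-neighbours-0 f = begin
      ∑ (sphere x 0) (λ z → ∑ (neighbours z) f)
        ≈⟨ sphere-neighbours 0 f ⟩
      ∑ (wordsUpTo B) (λ w → neighboursAt 0 (dist w x′) * extend f w)
        ≈⟨ ∑-cong (wordsUpTo B) (λ w → extend-guard f w (λ w-red →
             trans (count-at-0 (dist w x′)) (sym (onSphere-reduced 1 w w-red)))) ⟩
      ∑ (wordsUpTo B) (λ w → onSphere 1 w * extend f w)
        ≈⟨ sym (∑-sphere 1 f B ℕP.≤-refl) ⟩
      ∑ (sphere x 1) f ∎
      where
      B = length x′ ℕ.+ 1
      count-at-0 : ∀ m → neighboursAt 0 m ≈ 𝟙 (m ≡ᵇ 1)
      count-at-0 zero = zeroʳ _
      count-at-0 (suc m) = trans (+-congˡ (zeroʳ _)) (+-identityʳ _)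

    sphere-neighbours-suc : ∀ r f →
      ∑ (sphere x (suc r)) (λ z → ∑ (neighbours z) f)
        ≈ ι (branching r) * ∑ (sphere x r) f + ∑ (sphere x (suc (suc r))) f
    sphere-neighbours-suc r f = begin
      ∑ (sphere x (suc r)) (λ z → ∑ (neighbours z) f)
        ≈⟨ sphere-neighbours (suc r) f ⟩
      ∑ (wordsUpTo B) (λ w → neighboursAt (suc r) (dist w x′) * extend f w)
        ≈⟨ ∑-cong (wordsUpTo B) (λ w → extend-guard f w (λ w-red →
             trans (count-at-suc r (dist w x′))
                   (sym (+-cong (*-congˡ (onSphere-reduced r w w-red))
                                (onSphere-reduced (suc (suc r)) w w-red))))) ⟩
      ∑ (wordsUpTo B) (λ w → (ι (branching r) * onSphere r w + onSphere (suc (suc r)) w) * extend f w)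
        ≈⟨ ∑-cong (wordsUpTo B) (λ w → trans (distribʳ _ _ _) (+-congʳ (*-assoc _ _ _))) ⟩
      ∑ (wordsUpTo B) (λ w → ι (branching r) * (onSphere r w * extend f w)
                              + onSphere (suc (suc r)) w * extend f w)
        ≈⟨ ∑-+ (wordsUpTo B) _ _ ⟩
      ∑ (wordsUpTo B) (λ w → ι (branching r) * (onSphere r w * extend f w))
        + ∑ (wordsUpTo B) (λ w → onSphere (suc (suc r)) w * extend f w)
        ≈⟨ +-congʳ (∑-*ˡ (wordsUpTo B) _ _) ⟩
      ι (branching r) * ∑ (wordsUpTo B) (λ w → onSphere r w * extend f w)
        + ∑ (wordsUpTo B) (λ w → onSphere (suc (suc r)) w * extend f w)
        ≈⟨ +-cong (*-congˡ (sym (∑-sphere r f B (ℕP.+-monoʳ-≤ (length x′) (ℕP.m≤n+m r 2)))))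
                  (sym (∑-sphere (suc (suc r)) f B ℕP.≤-refl)) ⟩
      ι (branching r) * ∑ (sphere x r) f + ∑ (sphere x (suc (suc r))) f ∎
      where
      B = length x′ ℕ.+ suc (suc r)
      count-at-suc : ∀ r m → neighboursAt (suc r) m
                             ≈ ι (branching r) * 𝟙 (m ≡ᵇ r) + 𝟙 (m ≡ᵇ suc (suc r))
      count-at-suc zero zero = sym (+-identityʳ _)
      count-at-suc (suc r) zero = trans (zeroʳ _) (sym (trans (+-identityʳ _) (zeroʳ _)))
      count-at-suc zero (suc m) =
        trans (+-congˡ (zeroʳ _)) (trans (+-identityʳ _) (sym (trans (+-congʳ (zeroʳ _)) (+-identityˡ _))))
      count-at-suc (suc r) (suc m) = +-comm _ _

-- Spherical means on the tree with k = suc (suc j) ≥ 2, where every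
-- sphere is nonempty and S r is invertible in R.
module SphericalMeans {c ℓ : Level} (j : ℕ) (R : CommutativeRing c ℓ)
                      (inv : ℕ → CommutativeRing.Carrier R)
                      (inverses : Scalars.InversesOfPositiveIntegers R inv) where
  k₁ k : ℕ
  k₁ = suc j
  k = suc k₁
  open CommutativeRing R
  open Scalars R using (ι)
  open IntegerCoefficients R using (ι-+; ι-*; solve; _:=_; _:+_; _:-_; _:*_; con)
  open ListSums R
  open Tree k using (Vertex; S; sphere; neighbours)
  open Equations k R inv
  open SphereSums k₁ R using (module Around; branching)
  open import Relation.Binary.Reasoning.Setoid setoid

  S-nonZero : ∀ r → ℕ.NonZero (S r)
  S-nonZero zero = _
  S-nonZero (suc r) = ℕP.m*n≢0 k (k₁ ℕ.^ r) {{_}} {{ℕP.m^n≢0 k₁ r}}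

  ι-S-inverse : ∀ r → ι (S r) * inv (S r) ≈ 1#
  ι-S-inverse r = P.subst (λ t → ι t * inv t ≈ 1#) (ℕP.suc-pred (S r) {{S-nonZero r}})
                          (inverses (ℕ.pred (S r)))

  S-suc : ∀ r → S (suc r) ≡ branching r ℕ.* S r
  S-suc zero = P.refl
  S-suc (suc r) =
    P.trans (P.sym (ℕP.*-assoc k k₁ (k₁ ℕ.^ r)))
      (P.trans (P.cong (ℕ._* (k₁ ℕ.^ r)) (ℕP.*-comm k k₁)) (ℕP.*-assoc k₁ k (k₁ ℕ.^ r)))

  inv-S-suc : ∀ r → inv (S (suc r)) * ι (branching r) ≈ inv (S r)
  inv-S-suc r = begin
    a′ * ι b                        ≈⟨ sym (*-identityʳ _) ⟩
    (a′ * ι b) * 1#                 ≈⟨ *-congˡ (sym (ι-S-inverse r)) ⟩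
    (a′ * ι b) * (ι (S r) * a)      ≈⟨ solve 4 (λ a′ b s a → (a′ :* b) :* (s :* a) := (a′ :* (b :* s)) :* a)
                                            refl a′ (ι b) (ι (S r)) a ⟩
    (a′ * (ι b * ι (S r))) * a      ≈⟨ *-congʳ (*-congˡ (sym (trans (reflexive (P.cong ι (S-suc r))) (ι-* b (S r))))) ⟩
    (a′ * ι (S (suc r))) * a        ≈⟨ *-congʳ (trans (*-comm _ _) (ι-S-inverse (suc r))) ⟩
    1# * a                          ≈⟨ *-identityˡ a ⟩
    a                               ∎
    where
    a = inv (S r)
    a′ = inv (S (suc r))
    b = branching r

  inv-1 : inv 1 ≈ 1#
  inv-1 = trans (sym (*-identityˡ _)) (trans (*-congʳ (sym (+-identityʳ 1#))) (inverses 0))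

  module Means (u : Fn) (x : Vertex) where
    open Around x using (sphere-0; sphere-neighbours-0; sphere-neighbours-suc)

    mean-0 : ∀ g → g x ≈ inv (S 0) * ∑ (sphere x 0) g
    mean-0 g = sym (trans (*-congʳ inv-1) (trans (*-identityˡ _) (sphere-0 g)))

    mean-difference : ∀ r g h → inv (S r) * ∑ (sphere x r) g - inv (S r) * ∑ (sphere x r) h
                                ≈ inv (S r) * ∑ (sphere x r) (λ z → g z - h z)
    mean-difference r g h = trans (solve 3 (λ s a b → s :* a :- s :* b := s :* (a :- b)) refl _ _ _)
                                  (*-congˡ (sym (∑-- (sphere x r) g h)))

    mean-∂n : ∀ r n → ∂nM u x (ℤ.+ r) n ≈ inv (S r) * ∑ (sphere x r) (λ z → ∂n u z n)
    mean-∂n r n = mean-difference r _ _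

    mean-∂n² : ∀ r n → ∂n²M u x (ℤ.+ r) n ≈ inv (S r) * ∑ (sphere x r) (λ z → ∂n² u z n)
    mean-∂n² r n = trans (+-cong (mean-∂n r (suc n)) (-‿cong (mean-∂n r n))) (mean-difference r _ _)

    ∑-ΔT : ∀ r n → ∑ (sphere x r) (λ z → ΔT u z n)
                   ≈ ι k * ∑ (sphere x r) (λ z → u z n) - ∑ (sphere x r) (λ z → ∑ (neighbours z) (λ y → u y n))
    ∑-ΔT r n = trans (∑-- (sphere x r) _ _) (+-congʳ (∑-*ˡ (sphere x r) _ _))

    mean-ΔT : ∀ r n → LM u x (ℤ.+ r) n ≈ inv (S r) * ∑ (sphere x r) (λ z → ΔT u z n)
    mean-ΔT zero n = begin
      ι 2 * M₀ - M₁ - M₁ + (ι 2 - ι k) * (M₁ - M₀)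
        ≈⟨ solve 3 (λ M₀ M₁ K → con (ℤ.+ 2) :* M₀ :- M₁ :- M₁ :+ (con (ℤ.+ 2) :- K) :* (M₁ :- M₀)
                                  := K :* M₀ :- K :* M₁) refl M₀ M₁ (ι k) ⟩
      ι k * (a₀ * Σ₀) - ι k * (a₁ * Σ₁)
        ≈⟨ solve 5 (λ K a₀ Σ₀ a₁ Σ₁ → K :* (a₀ :* Σ₀) :- K :* (a₁ :* Σ₁)
                                      := a₀ :* (K :* Σ₀) :- (a₁ :* K) :* Σ₁) refl (ι k) a₀ Σ₀ a₁ Σ₁ ⟩
      a₀ * (ι k * Σ₀) - (a₁ * ι k) * Σ₁
        ≈⟨ +-congˡ (-‿cong (*-congʳ (inv-S-suc 0))) ⟩
      a₀ * (ι k * Σ₀) - a₀ * Σ₁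
        ≈⟨ solve 3 (λ a X Y → a :* X :- a :* Y := a :* (X :- Y)) refl a₀ (ι k * Σ₀) Σ₁ ⟩
      a₀ * (ι k * Σ₀ - Σ₁)
        ≈⟨ *-congˡ (+-congˡ (-‿cong (sym (sphere-neighbours-0 f)))) ⟩
      a₀ * (ι k * Σ₀ - ∑ (sphere x 0) (λ z → ∑ (neighbours z) f))
        ≈⟨ *-congˡ (sym (∑-ΔT 0 n)) ⟩
      a₀ * ∑ (sphere x 0) (λ z → ΔT u z n) ∎
      where
      f = λ z → u z n
      a₀ = inv (S 0)
      a₁ = inv (S 1)
      Σ₀ = ∑ (sphere x 0) f
      Σ₁ = ∑ (sphere x 1) f
      M₀ = a₀ * Σ₀
      M₁ = a₁ * Σ₁
    mean-ΔT (suc r) n = begin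
      LM u x (ℤ.+ suc r) n
        ≡⟨ P.cong (λ t → ι 2 * M₁ - M u x t n - M₀ + (ι 2 - ι k) * (M u x t n - M₁)) (ℕP.+-comm (suc r) 1) ⟩
      ι 2 * M₁ - M₂ - M₀ + (ι 2 - ι k) * (M₂ - M₁)
        ≈⟨ solve 4 (λ M₀ M₁ M₂ K → con (ℤ.+ 2) :* M₁ :- M₂ :- M₀ :+ (con (ℤ.+ 2) :- K) :* (M₂ :- M₁)
                                     := K :* M₁ :- M₀ :- (K :- con (ℤ.+ 1)) :* M₂) refl M₀ M₁ M₂ (ι k) ⟩
      ι k * M₁ - M₀ - (ι k - ι 1) * M₂
        ≈⟨ +-cong (+-congˡ (-‿cong M₀≈)) (-‿cong M₂≈) ⟩
      ι k * (a₁ * Σ₁) - (a₁ * ι b) * Σ₀ - a₁ * Σ₂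
        ≈⟨ solve 6 (λ K a₁ Σ₁ B Σ₀ Σ₂ → K :* (a₁ :* Σ₁) :- (a₁ :* B) :* Σ₀ :- a₁ :* Σ₂
                                        := a₁ :* (K :* Σ₁ :- (B :* Σ₀ :+ Σ₂))) refl (ι k) a₁ Σ₁ (ι b) Σ₀ Σ₂ ⟩
      a₁ * (ι k * Σ₁ - (ι b * Σ₀ + Σ₂))
        ≈⟨ *-congˡ (+-congˡ (-‿cong (sym (sphere-neighbours-suc r f)))) ⟩
      a₁ * (ι k * Σ₁ - ∑ (sphere x (suc r)) (λ z → ∑ (neighbours z) f))
        ≈⟨ *-congˡ (sym (∑-ΔT (suc r) n)) ⟩
      a₁ * ∑ (sphere x (suc r)) (λ z → ΔT u z n) ∎
      where
      f = λ z → u z n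
      b = branching r
      a₀ = inv (S r)
      a₁ = inv (S (suc r))
      a₂ = inv (S (suc (suc r)))
      Σ₀ = ∑ (sphere x r) f
      Σ₁ = ∑ (sphere x (suc r)) f
      Σ₂ = ∑ (sphere x (suc (suc r))) f
      M₀ = a₀ * Σ₀
      M₁ = a₁ * Σ₁
      M₂ = a₂ * Σ₂
      -- the inner sphere, rescaled to the normalisation of S(x, r+1)
      M₀≈ : M₀ ≈ (a₁ * ι b) * Σ₀
      M₀≈ = *-congʳ (sym (inv-S-suc r))
      -- the outer sphere, rescaled likewise
      M₂≈ : (ι k - ι 1) * M₂ ≈ a₁ * Σ₂
      M₂≈ = begin
        (ι k - ι 1) * (a₂ * Σ₂)  ≈⟨ *-congʳ (trans (+-congʳ (ι-+ 1 k₁)) (solve 2 (λ o s → (o :+ s) :- o := s) refl (ι 1) (ι k₁))) ⟩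
        ι k₁ * (a₂ * Σ₂)         ≈⟨ solve 3 (λ s a X → s :* (a :* X) := (a :* s) :* X) refl (ι k₁) a₂ Σ₂ ⟩
        (a₂ * ι k₁) * Σ₂         ≈⟨ *-congʳ (inv-S-suc (suc r)) ⟩
        a₁ * Σ₂                  ∎

  -- For any time operator D whose spherical mean is D_M, the equation
  -- Δ_T u + D u = 0 holds iff (Δ_P + (2-k) ∂_r) M_u + D_M M_u = 0: one way
  -- by averaging over spheres, the other by reading off radius 0.
  transference : (D : Fn → Vertex → ℕ → Carrier) (D-M : Fn → Vertex → ℤ → ℕ → Carrier) →
    (∀ u x r n → D-M u x (ℤ.+ r) n ≈ inv (S r) * ∑ (sphere x r) (λ z → D u z n)) → ∀ u →
    ((∀ x n → ΔT u x n + D u x n ≈ 0#) ⇔ (∀ x r n → LM u x (ℤ.+ r) n + D-M u x (ℤ.+ r) n ≈ 0#))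
  transference D D-M mean-D u = mk⇔ averaged at-radius-0
    where
    averaged : (∀ x n → ΔT u x n + D u x n ≈ 0#) → ∀ x r n → LM u x (ℤ.+ r) n + D-M u x (ℤ.+ r) n ≈ 0#
    averaged eq x r n = begin
      LM u x (ℤ.+ r) n + D-M u x (ℤ.+ r) n
        ≈⟨ +-cong (Means.mean-ΔT u x r n) (mean-D u x r n) ⟩
      inv (S r) * ∑ (sphere x r) (λ z → ΔT u z n) + inv (S r) * ∑ (sphere x r) (λ z → D u z n)
        ≈⟨ sym (distribˡ _ _ _) ⟩
      inv (S r) * (∑ (sphere x r) (λ z → ΔT u z n) + ∑ (sphere x r) (λ z → D u z n))
        ≈⟨ *-congˡ (sym (∑-+ (sphere x r) _ _)) ⟩
      inv (S r) * ∑ (sphere x r) (λ z → ΔT u z n + D u z n)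
        ≈⟨ *-congˡ (∑-zero (sphere x r) (λ z → eq z n)) ⟩
      inv (S r) * 0#
        ≈⟨ zeroʳ _ ⟩
      0# ∎
    at-radius-0 : (∀ x r n → LM u x (ℤ.+ r) n + D-M u x (ℤ.+ r) n ≈ 0#) → ∀ x n → ΔT u x n + D u x n ≈ 0#
    at-radius-0 eq x n = begin
      ΔT u x n + D u x n
        ≈⟨ +-cong (Means.mean-0 u x (λ z → ΔT u z n)) (Means.mean-0 u x (λ z → D u z n)) ⟩
      inv (S 0) * ∑ (sphere x 0) (λ z → ΔT u z n) + inv (S 0) * ∑ (sphere x 0) (λ z → D u z n)
        ≈⟨ sym (+-cong (Means.mean-ΔT u x 0 n) (mean-D u x 0 n)) ⟩
      LM u x (ℤ.+ 0) n + D-M u x (ℤ.+ 0) n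
        ≈⟨ eq x 0 n ⟩
      0# ∎

corollary4p3 : ∀ {c ℓ : Level} (k : ℕ) → 2 ≤ k → (R : CommutativeRing c ℓ)
    → (inv : ℕ → CommutativeRing.Carrier R)
    → Scalars.InversesOfPositiveIntegers R inv
    → (u : Tree.Vertex k → ℕ → CommutativeRing.Carrier R)
    → (Equations.HeatT k R inv u ⇔ Equations.HeatM k R inv u)
    × (Equations.WaveT k R inv u ⇔ Equations.WaveM k R inv u)
corollary4p3 (suc (suc j)) (s≤s (s≤s z≤n)) R inv inverses u =
  transference ∂n ∂nM Means.mean-∂n u , transference ∂n² ∂n²M Means.mean-∂n² u
  where
  open SphericalMeans j R inv inverses
  open Equations (suc (suc j)) R inv using (∂n; ∂nM; ∂n²; ∂n²M)
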